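{- Let $O$ and $P$ be finite posets on disjoint ground sets. Then for every nonnegative integer $m$, $$e(m,O+P)=e(m,O)\cdot e(m,P),$$ and, provided $O$ is nonempty, $$e(m,O\oplus P)=\sum_{j=1}^{d(O)} c(j,O)\,(j+d(P)-1)^m .$$
   Context: For posets $O$ on $X$ and $P$ on $Y$ with $X\cap Y=\emptyset$: the cardinal sum $O+P$ is the poset on $X\cup Y$ with order $\le_O\cup\le_P$; the ordinal sum $O\oplus P$ has order $\le_O\cup\le_P\cup(X\times Y)$ (every element of $X$ below every element of $Y$). For a finite poset $P$ on $K$ and a finite set $M$ disjoint from $K$ with $|M|=m$, $e(m,P)$ is the number of partial orders on $M\cup K$ inducing $P$ on $K$ whose set of minimal elements is exactly $M$. $d(\cdot)$ is the number of downsets. For a finite poset $O$, $c(j,O)=\sum_{i}(-1)^i\,|\{B\subseteq\operatorname{Min}O\mid |B|=i,\ d(O-B)=j\}|$, where $\operatorname{Min}O$ is the set of minimal elements and $O-B$ the subposet induced on the complement of $B$. -}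

module Defs where

open import Data.Nat using (ℕ; zero; suc; _+_; _*_; _∸_; _^_; _≡ᵇ_)
open import Data.Bool using (Bool; true; false; _∧_; _∨_; not; if_then_else_)
open import Data.Fin using (Fin; zero; suc; _↑ʳ_; splitAt; _≟_)
open import Data.Sum using (inj₁; inj₂)
open import Data.List using (List; []; _∷_; map; concatMap; filter; length; allFin; foldr)
open import Data.Integer using (ℤ; +_; -_; 1ℤ; 0ℤ) renaming (_+_ to _+ℤ_)
open import Relation.Nullary.Decidable using (⌊_⌋)
open import Relation.Binary.PropositionalEquality using (_≡_)
open import Data.Bool using (T)
open import Relation.Nullary.Decidable using (T?)

-- Relations on a finite ground set Fin n, as Boolean matrices:
-- R x y = true  means  x ≤ y.

Rel : ℕ → Set
Rel n = Fin n → Fin n → Bool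

record IsPoset {n : ℕ} (R : Rel n) : Set where
  field
    refl    : ∀ x → R x x ≡ true
    antisym : ∀ x y → R x y ≡ true → R y x ≡ true → x ≡ y
    trans   : ∀ x y z → R x y ≡ true → R y z ≡ true → R x z ≡ true

allFns : {A : Set} → (n : ℕ) → List A → List (Fin n → A)
allFns zero    xs = (λ ()) ∷ []
allFns (suc n) xs =
  concatMap (λ a → map (λ f → λ { zero → a ; (suc i) → f i }) (allFns n xs)) xs

bools : List Bool
bools = true ∷ false ∷ []

allSubsets : (n : ℕ) → List (Fin n → Bool)
allSubsets n = allFns n bools

allRels : (n : ℕ) → List (Rel n)
allRels n = allFns n (allFns n bools)

count : {A : Set} → (A → Bool) → List A → ℕ
count p xs = length (filter (λ x → T? (p x)) xs)

forallFin : (n : ℕ) → (Fin n → Bool) → Bool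
forallFin n p = foldr (λ x r → p x ∧ r) true (allFin n)

eqFin : {n : ℕ} → Fin n → Fin n → Bool
eqFin x y = ⌊ x ≟ y ⌋

_⇒b_ : Bool → Bool → Bool
a ⇒b b = not a ∨ b

_⇔b_ : Bool → Bool → Bool
a ⇔b b = (a ⇒b b) ∧ (b ⇒b a)

isPoset : {n : ℕ} → Rel n → Bool
isPoset {n} R =
  forallFin n (λ x → R x x)
  ∧ forallFin n (λ x → forallFin n (λ y → (R x y ∧ R y x) ⇒b eqFin x y))
  ∧ forallFin n (λ x → forallFin n (λ y → forallFin n (λ z →
      (R x y ∧ R y z) ⇒b R x z)))

isMin : {n : ℕ} → Rel n → Fin n → Bool
isMin {n} R x = forallFin n (λ y → R y x ⇒b eqFin y x)

-- Sums of posets.  Ground set of O is Fin a, of P is Fin b; the (disjoint)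
-- union is Fin (a + b), with Fin a embedded first and Fin b after it.

cardSum : {a b : ℕ} → Rel a → Rel b → Rel (a + b)
cardSum {a} O P x y with splitAt a x | splitAt a y
... | inj₁ i | inj₁ j = O i j
... | inj₂ i | inj₂ j = P i j
... | inj₁ _ | inj₂ _ = false
... | inj₂ _ | inj₁ _ = false

ordSum : {a b : ℕ} → Rel a → Rel b → Rel (a + b)
ordSum {a} O P x y with splitAt a x | splitAt a y
... | inj₁ i | inj₁ j = O i j
... | inj₂ i | inj₂ j = P i j
... | inj₁ _ | inj₂ _ = true
... | inj₂ _ | inj₁ _ = false

-- e(m, P): P a poset on K = Fin k, M = Fin m, M ∪ K = Fin (m + k) with the
-- first m elements forming M and K embedded via raise m.

inM : {m k : ℕ} → Fin (m + k) → Bool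
inM {m} x with splitAt m x
... | inj₁ _ = true
... | inj₂ _ = false

isExtension : (m : ℕ) {k : ℕ} → Rel k → Rel (m + k) → Bool
isExtension m {k} P Q =
  isPoset Q
  ∧ forallFin k (λ i → forallFin k (λ j → Q (m ↑ʳ i) (m ↑ʳ j) ⇔b P i j))
  ∧ forallFin (m + k) (λ x → isMin Q x ⇔b inM {m} {k} x)

e : (m : ℕ) {k : ℕ} → Rel k → ℕ
e m {k} P = count (isExtension m P) (allRels (m + k))

isDownsetOn : {n : ℕ} → Rel n → (Fin n → Bool) → (Fin n → Bool) → Bool
isDownsetOn {n} R U S =
  forallFin n (λ x → S x ⇒b U x)
  ∧ forallFin n (λ x → forallFin n (λ y → (S x ∧ U y ∧ R y x) ⇒b S y))

dOn : {n : ℕ} → Rel n → (Fin n → Bool) → ℕ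
dOn {n} R U = count (isDownsetOn R U) (allSubsets n)

d : {n : ℕ} → Rel n → ℕ
d R = dOn R (λ _ → true)

sumℤ : List ℤ → ℤ
sumℤ = foldr _+ℤ_ 0ℤ

size : {n : ℕ} → (Fin n → Bool) → ℕ
size {n} B = count B (allFin n)

signPow : ℕ → ℤ
signPow zero    = 1ℤ
signPow (suc i) = - signPow i

c : (j : ℕ) {n : ℕ} → Rel n → ℤ
c j {n} O =
  sumℤ (map (λ B → signPow (size B))
    (filter (λ B → T? (forallFin n (λ x → B x ⇒b isMin O x)
                       ∧ (dOn O (λ x → not (B x)) ≡ᵇ j)))
            (allSubsets n)))

sumFrom1 : ℕ → (ℕ → ℤ) → ℤ
sumFrom1 zero    f = 0ℤ
sumFrom1 (suc N) f = sumFrom1 N f +ℤ f (suc N)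

-- An extension Q of P on M ⊎ K whose minimal elements are exactly M is determined by the m sets
-- F i = {x ∈ K | i <Q x}: they are upsets of P whose union contains Min P, M is an antichain and
-- nothing of K lies below M; conversely every such family of upsets defines one extension.  So
-- e(m, P) counts m-tuples of upsets of P covering Min P.
-- For O + P an upset is a pair of upsets and Min (O + P) = Min O ⊎ Min P, so the count factorises.
-- For O ⊕ P with O nonempty, Min (O ⊕ P) = Min O.  Inclusion–exclusion over the set B ⊆ Min O of
-- minimal elements missed by every upset gives e(m, O ⊕ P) = Σ_B (−1)^|B| N(B)^m, where N(B) counts
-- the upsets of O ⊕ P disjoint from B.  Such an upset is an upset of P, or an upset of O disjoint from
-- B together with all of P, and only P itself is of both kinds; complementing inside O − B matches the
-- upsets of O disjoint from B with the downsets of O − B.  Hence N(B) = d(O − B) + d(P) − 1, and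
-- grouping B by j = d(O − B) yields the coefficients c(j, O).

module Submission where

open import Defs
open import Data.Nat using (ℕ; zero; suc; _+_; _*_; _∸_; _^_; _≥_; _≤_; _<_; _≡ᵇ_; z≤n)
import Data.Nat.Properties as ℕ
open import Data.Bool using (Bool; true; false; _∧_; _∨_; _xor_; not; if_then_else_; T)
import Data.Bool.Properties as Bool
open import Data.Fin using (Fin; zero; suc; _↑ˡ_; _↑ʳ_; splitAt; _≟_)
open import Data.Fin.Properties using (splitAt-↑ˡ; splitAt-↑ʳ; ↑ˡ-injective; ↑ʳ-injective)
open import Data.Vec.Functional using (_++_) renaming (_∷_ to _∷ᶠ_)
open import Data.Vec.Functional.Properties using (lookup-++ˡ; lookup-++ʳ; ++-cong)
open import Data.List using (List; []; _∷_; map; concatMap; filter; foldr; tabulate) renaming (_++_ to _++ₗ_)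
open import Data.Integer using (ℤ; +_; -_; 0ℤ; 1ℤ; +≤+) renaming (_+_ to _+ℤ_; _*_ to _*ℤ_; _-_ to _-ℤ_; _≤_ to _≤ℤ_)
import Data.Integer.Properties as ℤ
open import Data.Integer.Tactic.RingSolver using (solve-∀)
open import Data.Sum using (_⊎_; inj₁; inj₂)
open import Data.Product using (_×_; _,_; proj₁; proj₂; ∃)
open import Data.Empty using (⊥; ⊥-elim)
open import Relation.Nullary.Decidable using (T?; yes; no)
open import Relation.Binary.PropositionalEquality
open import Function using (_∘_; id)

∧-elim : ∀ {a b} → a ∧ b ≡ true → a ≡ true × b ≡ true
∧-elim {true} {true} _ = refl , refl

∧-intro : ∀ {a b} → a ≡ true → b ≡ true → a ∧ b ≡ true
∧-intro refl refl = refl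

∨-elim : ∀ {a b} → a ∨ b ≡ true → a ≡ true ⊎ b ≡ true
∨-elim {true} _ = inj₁ refl
∨-elim {false} e = inj₂ e

⇒b-elim : ∀ {a b} → (a ⇒b b) ≡ true → a ≡ true → b ≡ true
⇒b-elim {true} {true} _ _ = refl

⇒b-intro : ∀ {a b} → (a ≡ true → b ≡ true) → (a ⇒b b) ≡ true
⇒b-intro {true} f = f refl
⇒b-intro {false} f = refl

⇔b-elim : ∀ {a b} → (a ⇔b b) ≡ true → a ≡ b
⇔b-elim {true} {true} _ = refl
⇔b-elim {false} {false} _ = refl

⇔b-intro : ∀ {a b} → a ≡ b → (a ⇔b b) ≡ true
⇔b-intro {true} refl = refl
⇔b-intro {false} refl = refl

≡-from-⇔ : ∀ {a b} → (a ≡ true → b ≡ true) → (b ≡ true → a ≡ true) → a ≡ b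
≡-from-⇔ {true} {true} f g = refl
≡-from-⇔ {true} {false} f g = sym (f refl)
≡-from-⇔ {false} {true} f g = g refl
≡-from-⇔ {false} {false} f g = refl

true≢false : ∀ {a} → a ≡ true → a ≡ false → ⊥
true≢false refl ()

not≡true⇒≡false : ∀ {a} → not a ≡ true → a ≡ false
not≡true⇒≡false {false} _ = refl

≡false⇒not≡true : ∀ {a} → a ≡ false → not a ≡ true
≡false⇒not≡true refl = refl

∧-shuffle : ∀ u v l a → ((u ∧ v) ∧ l) ∧ a ≡ ((u ∧ a) ∧ v) ∧ l
∧-shuffle false v l a = refl
∧-shuffle true v l false = Bool.∧-zeroʳ _
∧-shuffle true v l true = Bool.∧-identityʳ _

eqFin⇒≡ : ∀ {n} {x y : Fin n} → eqFin x y ≡ true → x ≡ y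
eqFin⇒≡ {x = x} {y} e with x ≟ y
... | yes x≡y = x≡y

≡⇒eqFin : ∀ {n} {x y : Fin n} → x ≡ y → eqFin x y ≡ true
≡⇒eqFin {x = x} {y} x≡y with x ≟ y
... | yes _ = refl
... | no x≢y = ⊥-elim (x≢y x≡y)

every : (n : ℕ) → (Fin n → Bool) → Bool
every zero p = true
every (suc n) p = p zero ∧ every n (p ∘ suc)

some : (n : ℕ) → (Fin n → Bool) → Bool
some zero p = false
some (suc n) p = p zero ∨ some n (p ∘ suc)

countTrue : (n : ℕ) → (Fin n → Bool) → ℕ
countTrue zero p = 0
countTrue (suc n) p = (if p zero then 1 else 0) + countTrue n (p ∘ suc)

forallFin≡every : (n : ℕ) (p : Fin n → Bool) → forallFin n p ≡ every n p
forallFin≡every n p = foldr-tabulate n id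
  where
  foldr-tabulate : (k : ℕ) (g : Fin k → Fin n) →
    foldr (λ x r → p x ∧ r) true (tabulate g) ≡ every k (p ∘ g)
  foldr-tabulate zero g = refl
  foldr-tabulate (suc k) g = cong (p (g zero) ∧_) (foldr-tabulate k (g ∘ suc))

size≡countTrue : (n : ℕ) (B : Fin n → Bool) → size B ≡ countTrue n B
size≡countTrue n B = count-tabulate n id
  where
  count-tabulate : (k : ℕ) (g : Fin k → Fin n) → count B (tabulate g) ≡ countTrue k (B ∘ g)
  count-tabulate zero g = refl
  count-tabulate (suc k) g with B (g zero)
  ... | true = cong suc (count-tabulate k (g ∘ suc))
  ... | false = count-tabulate k (g ∘ suc)

every-cong : (n : ℕ) {p q : Fin n → Bool} → p ≗ q → every n p ≡ every n q
every-cong zero e = refl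
every-cong (suc n) e = cong₂ _∧_ (e zero) (every-cong n (e ∘ suc))

some-cong : (n : ℕ) {p q : Fin n → Bool} → p ≗ q → some n p ≡ some n q
some-cong zero e = refl
some-cong (suc n) e = cong₂ _∨_ (e zero) (some-cong n (e ∘ suc))

forallFin-cong : (n : ℕ) {p q : Fin n → Bool} → p ≗ q → forallFin n p ≡ forallFin n q
forallFin-cong n {p} {q} e =
  trans (forallFin≡every n p) (trans (every-cong n e) (sym (forallFin≡every n q)))

every-++ : (a b : ℕ) (p : Fin (a + b) → Bool) →
  every (a + b) p ≡ every a (λ i → p (i ↑ˡ b)) ∧ every b (λ j → p (a ↑ʳ j))
every-++ zero b p = refl
every-++ (suc a) b p =
  trans (cong (p zero ∧_) (every-++ a b (p ∘ suc))) (sym (Bool.∧-assoc (p zero) _ _))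

every-∧ : (n : ℕ) (p q : Fin n → Bool) → every n (λ i → p i ∧ q i) ≡ every n p ∧ every n q
every-∧ zero p q = refl
every-∧ (suc n) p q rewrite every-∧ n (p ∘ suc) (q ∘ suc) with p zero | q zero
... | true | true = refl
... | true | false = sym (Bool.∧-zeroʳ _)
... | false | _ = refl

every-true : (n : ℕ) → every n (λ _ → true) ≡ true
every-true zero = refl
every-true (suc n) = every-true n

every-elim : (n : ℕ) {p : Fin n → Bool} → every n p ≡ true → ∀ i → p i ≡ true
every-elim (suc n) e zero = proj₁ (∧-elim e)
every-elim (suc n) e (suc i) = every-elim n (proj₂ (∧-elim e)) i

every-intro : (n : ℕ) {p : Fin n → Bool} → (∀ i → p i ≡ true) → every n p ≡ true
every-intro zero f = refl
every-intro (suc n) f = ∧-intro (f zero) (every-intro n (f ∘ suc))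

every-false : (n : ℕ) {p : Fin n → Bool} → every n p ≡ false → ∃ λ i → p i ≡ false
every-false (suc n) {p} e with p zero in eq
... | false = zero , eq
... | true with every-false n e
... | i , e′ = suc i , e′

every-comm : (n k : ℕ) (f : Fin n → Fin k → Bool) →
  every n (λ x → every k (f x)) ≡ every k (λ i → every n (λ x → f x i))
every-comm n k f = ≡-from-⇔
  (λ h → every-intro k (λ i → every-intro n (λ x → every-elim k (every-elim n h x) i)))
  (λ h → every-intro n (λ x → every-intro k (λ i → every-elim n (every-elim k h i) x)))

some-intro : (n : ℕ) {p : Fin n → Bool} (i : Fin n) → p i ≡ true → some n p ≡ true
some-intro (suc n) zero e rewrite e = refl
some-intro (suc n) {p} (suc i) e =
  trans (cong (p zero ∨_) (some-intro n i e)) (Bool.∨-zeroʳ (p zero))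

some≡not-every-not : (n : ℕ) (p : Fin n → Bool) → some n p ≡ not (every n (not ∘ p))
some≡not-every-not zero p = refl
some≡not-every-not (suc n) p with p zero
... | true = refl
... | false = some≡not-every-not n (p ∘ suc)

⇒b-∧ : ∀ c p q → (c ⇒b (p ∧ q)) ≡ (c ⇒b p) ∧ (c ⇒b q)
⇒b-∧ true p q = refl
⇒b-∧ false p q = refl

⇒b-every : ∀ c n (g : Fin n → Bool) → (c ⇒b every n g) ≡ every n (λ i → c ⇒b g i)
⇒b-every true n g = refl
⇒b-every false n g = sym (every-true n)

⇒b-not : ∀ p r → (p ⇒b not r) ≡ not (p ∧ r)
⇒b-not true r = refl
⇒b-not false r = refl

forallFin-elim : (n : ℕ) {p : Fin n → Bool} → forallFin n p ≡ true → ∀ x → p x ≡ true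
forallFin-elim n {p} e = every-elim n (trans (sym (forallFin≡every n p)) e)

forallFin-intro : (n : ℕ) {p : Fin n → Bool} → (∀ x → p x ≡ true) → forallFin n p ≡ true
forallFin-intro n {p} f = trans (forallFin≡every n p) (every-intro n f)

forallFin-false : (n : ℕ) {p : Fin n → Bool} → forallFin n p ≡ false → ∃ λ x → p x ≡ false
forallFin-false n {p} e = every-false n (trans (sym (forallFin≡every n p)) e)

𝟙 : Bool → ℤ
𝟙 true = 1ℤ
𝟙 false = 0ℤ

𝟙-∧ : ∀ a b → 𝟙 (a ∧ b) ≡ 𝟙 a *ℤ 𝟙 b
𝟙-∧ true b = sym (ℤ.*-identityˡ _)
𝟙-∧ false b = refl

𝟙-mono : ∀ {a b} → (a ≡ true → b ≡ true) → 𝟙 a ≤ℤ 𝟙 b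
𝟙-mono {false} {false} f = ℤ.≤-refl
𝟙-mono {false} {true} f = +≤+ z≤n
𝟙-mono {true} f rewrite f refl = ℤ.≤-refl

𝟙-nonNeg : ∀ a → 0ℤ ≤ℤ 𝟙 a
𝟙-nonNeg true = +≤+ z≤n
𝟙-nonNeg false = ℤ.≤-refl

𝟙-inclusion–exclusion : ∀ x v z y → (z ≡ true → x ≡ true) → (y ≡ true → v ≡ true) →
  𝟙 ((x ∧ v) ∧ (z ∨ y)) ≡ (𝟙 x *ℤ 𝟙 y +ℤ 𝟙 z *ℤ 𝟙 v) -ℤ 𝟙 z *ℤ 𝟙 y
𝟙-inclusion–exclusion false v false y _ _ = refl
𝟙-inclusion–exclusion false v true y z⇒x _ with () ← z⇒x refl
𝟙-inclusion–exclusion true false z true _ y⇒v with () ← y⇒v refl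
𝟙-inclusion–exclusion true false false false _ _ = refl
𝟙-inclusion–exclusion true false true false _ _ = refl
𝟙-inclusion–exclusion true true false false _ _ = refl
𝟙-inclusion–exclusion true true false true _ _ = refl
𝟙-inclusion–exclusion true true true false _ _ = refl
𝟙-inclusion–exclusion true true true true _ _ = refl

∑ : {A : Set} → List A → (A → ℤ) → ℤ
∑ xs f = sumℤ (map f xs)

∑-++ : {A : Set} (xs ys : List A) (f : A → ℤ) → ∑ (xs ++ₗ ys) f ≡ ∑ xs f +ℤ ∑ ys f
∑-++ [] ys f = sym (ℤ.+-identityˡ _)
∑-++ (x ∷ xs) ys f rewrite ∑-++ xs ys f = sym (ℤ.+-assoc (f x) _ _)

∑-map : {A B : Set} (g : A → B) (xs : List A) (f : B → ℤ) → ∑ (map g xs) f ≡ ∑ xs (f ∘ g)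
∑-map g [] f = refl
∑-map g (x ∷ xs) f = cong (f (g x) +ℤ_) (∑-map g xs f)

∑-concatMap : {A B : Set} (g : A → List B) (xs : List A) (f : B → ℤ) →
  ∑ (concatMap g xs) f ≡ ∑ xs (λ a → ∑ (g a) f)
∑-concatMap g [] f = refl
∑-concatMap g (x ∷ xs) f =
  trans (∑-++ (g x) _ f) (cong (∑ (g x) f +ℤ_) (∑-concatMap g xs f))

∑-cong : {A : Set} (xs : List A) {f g : A → ℤ} → f ≗ g → ∑ xs f ≡ ∑ xs g
∑-cong [] e = refl
∑-cong (x ∷ xs) e = cong₂ _+ℤ_ (e x) (∑-cong xs e)

∑-zero : {A : Set} (xs : List A) → ∑ xs (λ _ → 0ℤ) ≡ 0ℤ
∑-zero [] = refl
∑-zero (x ∷ xs) = trans (ℤ.+-identityˡ _) (∑-zero xs)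

∑-distrib-+ : {A : Set} (xs : List A) (f g : A → ℤ) →
  ∑ xs (λ x → f x +ℤ g x) ≡ ∑ xs f +ℤ ∑ xs g
∑-distrib-+ [] f g = refl
∑-distrib-+ (x ∷ xs) f g rewrite ∑-distrib-+ xs f g = interchange (f x) (g x) (∑ xs f) (∑ xs g)
  where
  interchange : ∀ a b c d → (a +ℤ b) +ℤ (c +ℤ d) ≡ (a +ℤ c) +ℤ (b +ℤ d)
  interchange = solve-∀

∑-neg : {A : Set} (xs : List A) (f : A → ℤ) → ∑ xs (λ x → - f x) ≡ - ∑ xs f
∑-neg [] f = refl
∑-neg (x ∷ xs) f rewrite ∑-neg xs f = sym (ℤ.neg-distrib-+ (f x) _)

∑-*ˡ : {A : Set} (xs : List A) (c : ℤ) (f : A → ℤ) → ∑ xs (λ x → c *ℤ f x) ≡ c *ℤ ∑ xs f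
∑-*ˡ [] c f = sym (ℤ.*-zeroʳ c)
∑-*ˡ (x ∷ xs) c f rewrite ∑-*ˡ xs c f = sym (ℤ.*-distribˡ-+ c (f x) _)

∑-*ʳ : {A : Set} (xs : List A) (c : ℤ) (f : A → ℤ) → ∑ xs (λ x → f x *ℤ c) ≡ ∑ xs f *ℤ c
∑-*ʳ xs c f = trans (∑-cong xs (λ x → ℤ.*-comm (f x) c)) (trans (∑-*ˡ xs c f) (ℤ.*-comm c _))

∑-comm : {A B : Set} (xs : List A) (ys : List B) (f : A → B → ℤ) →
  ∑ xs (λ x → ∑ ys (f x)) ≡ ∑ ys (λ y → ∑ xs (λ x → f x y))
∑-comm [] ys f = sym (∑-zero ys)
∑-comm (x ∷ xs) ys f = trans (cong (∑ ys (f x) +ℤ_) (∑-comm xs ys f))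
  (sym (∑-distrib-+ ys (f x) (λ y → ∑ xs (λ x′ → f x′ y))))

∑∑-* : {A B : Set} (xs : List A) (ys : List B) (f : A → ℤ) (g : B → ℤ) →
  ∑ xs (λ x → ∑ ys (λ y → f x *ℤ g y)) ≡ ∑ xs f *ℤ ∑ ys g
∑∑-* xs ys f g = trans (∑-cong xs (λ x → ∑-*ˡ ys (f x) g)) (∑-*ʳ xs (∑ ys g) f)

∑∑-linear : {A B : Set} (xs : List A) (ys : List B) (f₁ f₂ f₃ : A → ℤ) (g₁ g₂ g₃ : B → ℤ) →
  ∑ xs (λ x → ∑ ys (λ y → (f₁ x *ℤ g₁ y +ℤ f₂ x *ℤ g₂ y) -ℤ f₃ x *ℤ g₃ y))
    ≡ (∑ xs f₁ *ℤ ∑ ys g₁ +ℤ ∑ xs f₂ *ℤ ∑ ys g₂) -ℤ ∑ xs f₃ *ℤ ∑ ys g₃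
∑∑-linear xs ys f₁ f₂ f₃ g₁ g₂ g₃ = begin
  ∑ xs (λ x → ∑ ys (λ y → (f₁ x *ℤ g₁ y +ℤ f₂ x *ℤ g₂ y) -ℤ f₃ x *ℤ g₃ y))
    ≡⟨ ∑-cong xs (λ x → linear ys (λ y → f₁ x *ℤ g₁ y) (λ y → f₂ x *ℤ g₂ y) (λ y → f₃ x *ℤ g₃ y)) ⟩
  ∑ xs (λ x → (∑ ys (λ y → f₁ x *ℤ g₁ y) +ℤ ∑ ys (λ y → f₂ x *ℤ g₂ y)) -ℤ ∑ ys (λ y → f₃ x *ℤ g₃ y))
    ≡⟨ linear xs _ _ _ ⟩
  (∑ xs (λ x → ∑ ys (λ y → f₁ x *ℤ g₁ y)) +ℤ ∑ xs (λ x → ∑ ys (λ y → f₂ x *ℤ g₂ y)))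
    -ℤ ∑ xs (λ x → ∑ ys (λ y → f₃ x *ℤ g₃ y))
    ≡⟨ cong₂ _-ℤ_ (cong₂ _+ℤ_ (∑∑-* xs ys f₁ g₁) (∑∑-* xs ys f₂ g₂)) (∑∑-* xs ys f₃ g₃) ⟩
  (∑ xs f₁ *ℤ ∑ ys g₁ +ℤ ∑ xs f₂ *ℤ ∑ ys g₂) -ℤ ∑ xs f₃ *ℤ ∑ ys g₃ ∎
  where
  open ≡-Reasoning
  linear : {C : Set} (zs : List C) (h₁ h₂ h₃ : C → ℤ) →
    ∑ zs (λ z → (h₁ z +ℤ h₂ z) -ℤ h₃ z) ≡ (∑ zs h₁ +ℤ ∑ zs h₂) -ℤ ∑ zs h₃
  linear zs h₁ h₂ h₃ = trans (∑-distrib-+ zs _ (λ z → - h₃ z))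
    (cong₂ _+ℤ_ (∑-distrib-+ zs h₁ h₂) (∑-neg zs h₃))

∑-*-unit : {A : Set} (xs : List A) (c : ℤ) {u : A → ℤ} → ∑ xs u ≡ 1ℤ → ∑ xs (λ x → c *ℤ u x) ≡ c
∑-*-unit xs c {u} total = trans (∑-*ˡ xs c u) (trans (cong (c *ℤ_) total) (ℤ.*-identityʳ c))

∑-mono-≤ : {A : Set} (xs : List A) {f g : A → ℤ} → (∀ x → f x ≤ℤ g x) → ∑ xs f ≤ℤ ∑ xs g
∑-mono-≤ [] h = ℤ.≤-refl
∑-mono-≤ (x ∷ xs) h = ℤ.+-mono-≤ (h x) (∑-mono-≤ xs h)

count≡∑𝟙 : {A : Set} (p : A → Bool) (xs : List A) → + count p xs ≡ ∑ xs (𝟙 ∘ p)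
count≡∑𝟙 p [] = refl
count≡∑𝟙 p (x ∷ xs) with p x
... | true = trans (ℤ.pos-+ 1 (count p xs)) (cong (1ℤ +ℤ_) (count≡∑𝟙 p xs))
... | false = trans (count≡∑𝟙 p xs) (sym (ℤ.+-identityˡ _))

∑-filter : {A : Set} (p : A → Bool) (f : A → ℤ) (xs : List A) →
  ∑ (filter (λ x → T? (p x)) xs) f ≡ ∑ xs (λ x → 𝟙 (p x) *ℤ f x)
∑-filter p f [] = refl
∑-filter p f (x ∷ xs) with p x
... | true = cong₂ _+ℤ_ (sym (ℤ.*-identityˡ (f x))) (∑-filter p f xs)
... | false = trans (∑-filter p f xs) (sym (ℤ.+-identityˡ _))

∑Fns : {A : Set} (n : ℕ) → List A → ((Fin n → A) → ℤ) → ℤ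
∑Fns n xs F = ∑ (allFns n xs) F

∑Subsets : (n : ℕ) → ((Fin n → Bool) → ℤ) → ℤ
∑Subsets n = ∑Fns n bools

Respects≗ : {A : Set} {n : ℕ} → ((Fin n → A) → ℤ) → Set
Respects≗ F = ∀ {f g} → f ≗ g → F f ≡ F g

∑Fns-suc : {A : Set} (n : ℕ) (xs : List A) {F : (Fin (suc n) → A) → ℤ} → Respects≗ F →
  ∑Fns (suc n) xs F ≡ ∑ xs (λ a → ∑Fns n xs (λ f → F (a ∷ᶠ f)))
∑Fns-suc n xs {F} resp = trans (∑-concatMap _ xs F) (∑-cong xs (λ a →
  trans (∑-map _ (allFns n xs) F) (∑-cong (allFns n xs) (λ f →
    resp (λ { zero → refl ; (suc i) → refl })))))

∏ : (n : ℕ) → (Fin n → ℤ) → ℤ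
∏ zero h = 1ℤ
∏ (suc n) h = h zero *ℤ ∏ n (h ∘ suc)

∏-cong : (n : ℕ) {g h : Fin n → ℤ} → g ≗ h → ∏ n g ≡ ∏ n h
∏-cong zero e = refl
∏-cong (suc n) e = cong₂ _*ℤ_ (e zero) (∏-cong n (e ∘ suc))

∏-const : (n c : ℕ) → ∏ n (λ _ → + c) ≡ + (c ^ n)
∏-const zero c = refl
∏-const (suc n) c = trans (cong (+ c *ℤ_) (∏-const n c)) (sym (ℤ.pos-* c _))

∏-one : (n : ℕ) → ∏ n (λ _ → 1ℤ) ≡ 1ℤ
∏-one n = trans (∏-const n 1) (cong +_ (ℕ.^-zeroˡ n))

𝟙-every : (n : ℕ) (p : Fin n → Bool) → 𝟙 (every n p) ≡ ∏ n (𝟙 ∘ p)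
𝟙-every zero p = refl
𝟙-every (suc n) p = trans (𝟙-∧ (p zero) _) (cong (𝟙 (p zero) *ℤ_) (𝟙-every n (p ∘ suc)))

∑Fns-∏ : {A : Set} (n : ℕ) (xs : List A) (g : Fin n → A → ℤ) →
  ∑Fns n xs (λ f → ∏ n (λ i → g i (f i))) ≡ ∏ n (λ i → ∑ xs (g i))
∑Fns-∏ zero xs g = ℤ.+-identityʳ 1ℤ
∑Fns-∏ (suc n) xs g = begin
  ∑Fns (suc n) xs (λ f → ∏ (suc n) (λ i → g i (f i)))
    ≡⟨ ∑Fns-suc n xs (λ e → ∏-cong (suc n) (λ i → cong (g i) (e i))) ⟩
  ∑ xs (λ a → ∑Fns n xs (λ f → g zero a *ℤ ∏ n (λ i → g (suc i) (f i))))
    ≡⟨ ∑-cong xs (λ a → ∑-*ˡ (allFns n xs) (g zero a) _) ⟩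
  ∑ xs (λ a → g zero a *ℤ ∑Fns n xs (λ f → ∏ n (λ i → g (suc i) (f i))))
    ≡⟨ ∑-cong xs (λ a → cong (g zero a *ℤ_) (∑Fns-∏ n xs (g ∘ suc))) ⟩
  ∑ xs (λ a → g zero a *ℤ ∏ n (λ i → ∑ xs (g (suc i))))
    ≡⟨ ∑-*ʳ xs _ (g zero) ⟩
  ∑ xs (g zero) *ℤ ∏ n (λ i → ∑ xs (g (suc i))) ∎
  where open ≡-Reasoning

∷-++ : {A : Set} {m k : ℕ} (a : A) (f : Fin m → A) (g : Fin k → A) → a ∷ᶠ (f ++ g) ≗ (a ∷ᶠ f) ++ g
∷-++ a f g zero = refl
∷-++ {m = m} a f g (suc i) with splitAt m i
... | inj₁ _ = refl
... | inj₂ _ = refl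

∑Fns-++ : {A : Set} (m k : ℕ) (xs : List A) {F : (Fin (m + k) → A) → ℤ} → Respects≗ F →
  ∑Fns (m + k) xs F ≡ ∑Fns m xs (λ f → ∑Fns k xs (λ g → F (f ++ g)))
∑Fns-++ zero k xs resp = sym (ℤ.+-identityʳ _)
∑Fns-++ (suc m) k xs {F} resp = begin
  ∑Fns (suc m + k) xs F
    ≡⟨ ∑Fns-suc (m + k) xs resp ⟩
  ∑ xs (λ a → ∑Fns (m + k) xs (λ h → F (a ∷ᶠ h)))
    ≡⟨ ∑-cong xs (λ a → ∑Fns-++ m k xs (λ e → resp (λ { zero → refl ; (suc i) → e i }))) ⟩
  ∑ xs (λ a → ∑Fns m xs (λ f → ∑Fns k xs (λ g → F (a ∷ᶠ (f ++ g)))))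
    ≡⟨ ∑-cong xs (λ a → ∑-cong (allFns m xs) (λ f → ∑-cong (allFns k xs) (λ g →
         resp (∷-++ a f g)))) ⟩
  ∑ xs (λ a → ∑Fns m xs (λ f → ∑Fns k xs (λ g → F ((a ∷ᶠ f) ++ g))))
    ≡⟨ ∑Fns-suc m xs (λ e → ∑-cong (allFns k xs) (λ g → resp (++-cong _ _ e (λ _ → refl)))) ⟨
  ∑Fns (suc m) xs (λ f → ∑Fns k xs (λ g → F (f ++ g))) ∎
  where open ≡-Reasoning

Mat : ℕ → ℕ → Set
Mat n k = Fin n → Fin k → Bool

∑Mat : (n k : ℕ) → (Mat n k → ℤ) → ℤ
∑Mat n k = ∑Fns n (allSubsets k)

_≋_ : {n k : ℕ} → Mat n k → Mat n k → Set
M ≋ N = ∀ i → M i ≗ N i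

++-cong≋ : {m k n : ℕ} {T T′ : Mat m n} {U U′ : Mat k n} → T ≋ T′ → U ≋ U′ → (T ++ U) ≋ (T′ ++ U′)
++-cong≋ {m} eT eU x with splitAt m x
... | inj₁ i = eT i
... | inj₂ j = eU j

Respects≋ : {n k : ℕ} → (Mat n k → ℤ) → Set
Respects≋ F = ∀ {M N} → M ≋ N → F M ≡ F N

∑Mat-++ : (n m k : ℕ) {F : Mat n (m + k) → ℤ} → Respects≋ F →
  ∑Mat n (m + k) F ≡ ∑Mat n m (λ L → ∑Mat n k (λ R → F (λ i → L i ++ R i)))
∑Mat-++ zero m k resp = trans (cong (_+ℤ 0ℤ) (resp (λ ()))) (sym (ℤ.+-identityʳ _))
∑Mat-++ (suc n) m k {F} resp = begin
  ∑Mat (suc n) (m + k) F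
    ≡⟨ ∑Fns-suc n rows (λ e → resp (λ i → cong-app (e i))) ⟩
  ∑ rows (λ r → ∑Mat n (m + k) (λ M → F (r ∷ᶠ M)))
    ≡⟨ ∑Fns-++ m k bools (λ e → ∑-cong (allFns n rows) (λ M →
         resp (λ { zero → e ; (suc i) → λ _ → refl }))) ⟩
  ∑Subsets m (λ u → ∑Subsets k (λ v → ∑Mat n (m + k) (λ M → F ((u ++ v) ∷ᶠ M))))
    ≡⟨ ∑-cong (allSubsets m) (λ u → ∑-cong (allSubsets k) (λ v → ∑Mat-++ n m k (λ e →
         resp (λ { zero → λ _ → refl ; (suc i) → e i })))) ⟩
  ∑Subsets m (λ u → ∑Subsets k (λ v → ∑Mat n m (λ L → ∑Mat n k (λ R →
    F ((u ++ v) ∷ᶠ (λ i → L i ++ R i))))))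
    ≡⟨ ∑-cong (allSubsets m) (λ u → trans (∑-comm (allSubsets k) (allFns n (allSubsets m)) _)
         (∑-cong (allFns n (allSubsets m)) (λ L → ∑-cong (allSubsets k) (λ v →
           ∑-cong (allFns n (allSubsets k)) (λ R →
             resp (λ { zero → λ _ → refl ; (suc i) → λ _ → refl })))))) ⟩
  ∑Subsets m (λ u → ∑Mat n m (λ L → ∑Subsets k (λ v → ∑Mat n k (λ R →
    F (λ i → (u ∷ᶠ L) i ++ (v ∷ᶠ R) i)))))
    ≡⟨ ∑-cong (allSubsets m) (λ u → ∑-cong (allFns n (allSubsets m)) (λ L →
         ∑Fns-suc n (allSubsets k) (λ e → resp (λ i → ++-cong _ _ (λ _ → refl) (cong-app (e i)))))) ⟨
  ∑Subsets m (λ u → ∑Mat n m (λ L → ∑Mat (suc n) k (λ R → F (λ i → (u ∷ᶠ L) i ++ R i))))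
    ≡⟨ ∑Fns-suc n (allSubsets m) (λ e → ∑-cong (allFns (suc n) (allSubsets k)) (λ R →
         resp (λ i → ++-cong _ _ (cong-app (e i)) (λ _ → refl)))) ⟨
  ∑Mat (suc n) m (λ L → ∑Mat (suc n) k (λ R → F (λ i → L i ++ R i))) ∎
  where
  open ≡-Reasoning
  rows : List (Fin (m + k) → Bool)
  rows = allSubsets (m + k)

∑Subsets-xor : (n : ℕ) (t : Fin n → Bool) {H : (Fin n → Bool) → ℤ} → Respects≗ H →
  ∑Subsets n H ≡ ∑Subsets n (λ S → H (λ x → t x xor S x))
∑Subsets-xor zero t resp = cong (_+ℤ 0ℤ) (resp (λ ()))
∑Subsets-xor (suc n) t {H} resp = begin
  ∑Subsets (suc n) H
    ≡⟨ ∑Fns-suc n bools resp ⟩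
  ∑ bools (λ a → ∑Subsets n (λ f → H (a ∷ᶠ f)))
    ≡⟨ ∑-cong bools (λ a → ∑Subsets-xor n (t ∘ suc) {λ f → H (a ∷ᶠ f)}
         (λ e → resp (λ { zero → refl ; (suc i) → e i }))) ⟩
  ∑ bools (λ a → ∑Subsets n (λ f → H (a ∷ᶠ (λ x → t (suc x) xor f x))))
    ≡⟨ ∑bools-xor (t zero) (λ a → ∑Subsets n (λ f → H (a ∷ᶠ (λ x → t (suc x) xor f x)))) ⟩
  ∑ bools (λ a → ∑Subsets n (λ f → H ((t zero xor a) ∷ᶠ (λ x → t (suc x) xor f x))))
    ≡⟨ ∑-cong bools (λ a → ∑-cong (allSubsets n) (λ f →
         resp {(t zero xor a) ∷ᶠ (λ x → t (suc x) xor f x)} {λ x → t x xor (a ∷ᶠ f) x}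
           (λ { zero → refl ; (suc i) → refl }))) ⟩
  ∑ bools (λ a → ∑Subsets n (λ f → H (λ x → t x xor (a ∷ᶠ f) x)))
    ≡⟨ ∑Fns-suc n bools (λ e → resp (λ x → cong (t x xor_) (e x))) ⟨
  ∑Subsets (suc n) (λ S → H (λ x → t x xor S x)) ∎
  where
  open ≡-Reasoning
  ∑bools-xor : (b : Bool) (h : Bool → ℤ) → ∑ bools h ≡ ∑ bools (λ a → h (b xor a))
  ∑bools-xor false h = refl
  ∑bools-xor true h = swap (h true) (h false)
    where
    swap : ∀ x y → x +ℤ (y +ℤ 0ℤ) ≡ y +ℤ (x +ℤ 0ℤ)
    swap = solve-∀

∅-≤-∑Subsets : (n : ℕ) {H : (Fin n → Bool) → ℤ} → Respects≗ H → (∀ S → 0ℤ ≤ℤ H S) →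
  H (λ _ → false) ≤ℤ ∑Subsets n H
∅-≤-∑Subsets zero resp nonNeg = ℤ.≤-reflexive (trans (resp (λ ())) (sym (ℤ.+-identityʳ _)))
∅-≤-∑Subsets (suc n) {H} resp nonNeg = begin
  H (λ _ → false)
    ≡⟨ trans (resp (λ { zero → refl ; (suc i) → refl })) (sym (ℤ.+-identityˡ _)) ⟩
  0ℤ +ℤ H (false ∷ᶠ (λ _ → false))
    ≤⟨ ℤ.+-mono-≤ (∑-nonNeg (allSubsets n) (λ _ → nonNeg _))
         (∅-≤-∑Subsets n (λ e → resp (λ { zero → refl ; (suc i) → e i })) (λ _ → nonNeg _)) ⟩
  ∑Subsets n (λ f → H (true ∷ᶠ f)) +ℤ ∑Subsets n (λ f → H (false ∷ᶠ f))
    ≡⟨ cong (∑Subsets n (λ f → H (true ∷ᶠ f)) +ℤ_) (sym (ℤ.+-identityʳ _)) ⟩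
  ∑ bools (λ a → ∑Subsets n (λ f → H (a ∷ᶠ f)))
    ≡⟨ ∑Fns-suc n bools resp ⟨
  ∑Subsets (suc n) H ∎
  where
  open ℤ.≤-Reasoning
  ∑-nonNeg : {A : Set} (xs : List A) {f : A → ℤ} → (∀ x → 0ℤ ≤ℤ f x) → 0ℤ ≤ℤ ∑ xs f
  ∑-nonNeg xs h = ℤ.≤-trans (ℤ.≤-reflexive (sym (∑-zero xs))) (∑-mono-≤ xs h)

∑Fns-every : {A : Set} (n : ℕ) (xs : List A) (p : Fin n → A → Bool) →
  ∑Fns n xs (λ f → 𝟙 (every n (λ i → p i (f i)))) ≡ ∏ n (λ i → ∑ xs (𝟙 ∘ p i))
∑Fns-every n xs p =
  trans (∑-cong (allFns n xs) (λ f → 𝟙-every n (λ i → p i (f i)))) (∑Fns-∏ n xs (λ i → 𝟙 ∘ p i))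

∑Subsets-unique : (n : ℕ) (p : Fin n → Bool → Bool) → (∀ i → ∑ bools (𝟙 ∘ p i) ≡ 1ℤ) →
  ∑Subsets n (λ S → 𝟙 (every n (λ i → p i (S i)))) ≡ 1ℤ
∑Subsets-unique n p unique = trans (∑Fns-every n bools p) (trans (∏-cong n unique) (∏-one n))

∑Subsets-full : (n : ℕ) → ∑Subsets n (λ S → 𝟙 (every n S)) ≡ 1ℤ
∑Subsets-full n = ∑Subsets-unique n (λ _ b → b) (λ _ → refl)

∑Subsets-empty : (n : ℕ) → ∑Subsets n (λ S → 𝟙 (every n (not ∘ S))) ≡ 1ℤ
∑Subsets-empty n = ∑Subsets-unique n (λ _ → not) (λ _ → refl)

matEq : {n l : ℕ} → Mat n l → Mat n l → Bool
matEq {n} {l} M N = every n (λ i → every l (λ j → M i j ⇔b N i j))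

matEq-elim : {n l : ℕ} {M N : Mat n l} → matEq M N ≡ true → M ≋ N
matEq-elim {n} {l} e i j = ⇔b-elim (every-elim l (every-elim n e i) j)

matEq-intro : {n l : ℕ} {M N : Mat n l} → M ≋ N → matEq M N ≡ true
matEq-intro {n} {l} e = every-intro n (λ i → every-intro l (λ j → ⇔b-intro (e i j)))

∑Mat-matEq : (n l : ℕ) (N : Mat n l) → ∑Mat n l (λ M → 𝟙 (matEq M N)) ≡ 1ℤ
∑Mat-matEq n l N = begin
  ∑Mat n l (λ M → 𝟙 (matEq M N))
    ≡⟨ ∑Fns-every n (allSubsets l) (λ i r → every l (λ j → r j ⇔b N i j)) ⟩
  ∏ n (λ i → ∑Subsets l (λ r → 𝟙 (every l (λ j → r j ⇔b N i j))))
    ≡⟨ ∏-cong n (λ i → ∑Subsets-unique l (λ j b → b ⇔b N i j) (λ j → unique (N i j))) ⟩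
  ∏ n (λ _ → 1ℤ)
    ≡⟨ ∏-one n ⟩
  1ℤ ∎
  where
  open ≡-Reasoning
  unique : ∀ v → ∑ bools (λ b → 𝟙 (b ⇔b v)) ≡ 1ℤ
  unique true = refl
  unique false = refl

negIf : Bool → ℤ
negIf true = - 1ℤ
negIf false = 1ℤ

signPow-countTrue : (n : ℕ) (B : Fin n → Bool) → signPow (countTrue n B) ≡ ∏ n (negIf ∘ B)
signPow-countTrue zero B = refl
signPow-countTrue (suc n) B with B zero
... | true = trans (cong -_ (signPow-countTrue n (B ∘ suc))) (sym (ℤ.-1*i≡-i _))
... | false = trans (signPow-countTrue n (B ∘ suc)) (sym (ℤ.*-identityˡ _))

∏-* : (n : ℕ) (g h : Fin n → ℤ) → ∏ n (λ i → g i *ℤ h i) ≡ ∏ n g *ℤ ∏ n h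
∏-* zero g h = refl
∏-* (suc n) g h rewrite ∏-* n (g ∘ suc) (h ∘ suc) = interchange (g zero) (h zero) (∏ n (g ∘ suc)) (∏ n (h ∘ suc))
  where
  interchange : ∀ a b c d → (a *ℤ b) *ℤ (c *ℤ d) ≡ (a *ℤ c) *ℤ (b *ℤ d)
  interchange = solve-∀

∑Subsets-inclusion–exclusion : (n : ℕ) (W : Fin n → Bool) →
  ∑Subsets n (λ B → 𝟙 (every n (λ x → B x ⇒b W x)) *ℤ signPow (countTrue n B)) ≡ 𝟙 (every n (not ∘ W))
∑Subsets-inclusion–exclusion n W = begin
  ∑Subsets n (λ B → 𝟙 (every n (λ x → B x ⇒b W x)) *ℤ signPow (countTrue n B))
    ≡⟨ ∑-cong (allSubsets n) (λ B → cong₂ _*ℤ_ (𝟙-every n _) (signPow-countTrue n B)) ⟩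
  ∑Subsets n (λ B → ∏ n (λ x → 𝟙 (B x ⇒b W x)) *ℤ ∏ n (negIf ∘ B))
    ≡⟨ ∑-cong (allSubsets n) (λ B → ∏-* n _ _) ⟨
  ∑Subsets n (λ B → ∏ n (λ x → 𝟙 (B x ⇒b W x) *ℤ negIf (B x)))
    ≡⟨ ∑Fns-∏ n bools (λ x b → 𝟙 (b ⇒b W x) *ℤ negIf b) ⟩
  ∏ n (λ x → ∑ bools (λ b → 𝟙 (b ⇒b W x) *ℤ negIf b))
    ≡⟨ ∏-cong n (λ x → signed-sum (W x)) ⟩
  ∏ n (λ x → 𝟙 (not (W x)))
    ≡⟨ 𝟙-every n (not ∘ W) ⟨
  𝟙 (every n (not ∘ W)) ∎
  where
  open ≡-Reasoning
  signed-sum : ∀ w → ∑ bools (λ b → 𝟙 (b ⇒b w) *ℤ negIf b) ≡ 𝟙 (not w)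
  signed-sum true = refl
  signed-sum false = refl

data View (m k : ℕ) : Fin (m + k) → Set where
  left : (i : Fin m) → View m k (i ↑ˡ k)
  right : (j : Fin k) → View m k (m ↑ʳ j)

view : ∀ m k (x : Fin (m + k)) → View m k x
view zero k x = right x
view (suc m) k zero = left zero
view (suc m) k (suc x) with view m k x
... | left i = left (suc i)
... | right j = right j

↑ˡ≢↑ʳ : ∀ {m k} (i : Fin m) (j : Fin k) → i ↑ˡ k ≡ m ↑ʳ j → ⊥
↑ˡ≢↑ʳ {m} {k} i j e
  with trans (sym (splitAt-↑ˡ m i k)) (trans (cong (splitAt m) e) (splitAt-↑ʳ m k j))
... | ()

inM-↑ˡ : ∀ {m k} (i : Fin m) → inM {m} {k} (i ↑ˡ k) ≡ true
inM-↑ˡ {m} {k} i rewrite splitAt-↑ˡ m i k = refl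

inM-↑ʳ : ∀ {m k} (j : Fin k) → inM {m} {k} (m ↑ʳ j) ≡ false
inM-↑ʳ {m} {k} j rewrite splitAt-↑ʳ m k j = refl

isPoset⇒IsPoset : ∀ {n} (R : Rel n) → isPoset R ≡ true → IsPoset R
isPoset⇒IsPoset {n} R e = record
  { refl = forallFin-elim n (proj₁ (∧-elim {ρ} e))
  ; antisym = λ x y r s →
      eqFin⇒≡ (⇒b-elim (forallFin-elim n (forallFin-elim n (proj₁ (∧-elim {α} ατ)) x) y) (∧-intro r s))
  ; trans = λ x y z r s →
      ⇒b-elim (forallFin-elim n (forallFin-elim n (forallFin-elim n (proj₂ (∧-elim {α} ατ)) x) y) z) (∧-intro r s)
  }
  where
  ρ α τ : Bool
  ρ = forallFin n (λ x → R x x)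
  α = forallFin n (λ x → forallFin n (λ y → (R x y ∧ R y x) ⇒b eqFin x y))
  τ = forallFin n (λ x → forallFin n (λ y → forallFin n (λ z → (R x y ∧ R y z) ⇒b R x z)))
  ατ : α ∧ τ ≡ true
  ατ = proj₂ (∧-elim {ρ} e)

IsPoset⇒isPoset : ∀ {n} (R : Rel n) → IsPoset R → isPoset R ≡ true
IsPoset⇒isPoset {n} R p = ∧-intro (forallFin-intro n (IsPoset.refl p)) (∧-intro
  (forallFin-intro n (λ x → forallFin-intro n (λ y → ⇒b-intro (λ h →
    let (r , s) = ∧-elim h in ≡⇒eqFin (IsPoset.antisym p x y r s)))))
  (forallFin-intro n (λ x → forallFin-intro n (λ y → forallFin-intro n (λ z → ⇒b-intro (λ h →
    let (r , s) = ∧-elim h in IsPoset.trans p x y z r s))))))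

isMin⇒minimal : ∀ {n} (R : Rel n) {x} → isMin R x ≡ true → ∀ y → R y x ≡ true → y ≡ x
isMin⇒minimal {n} R e y r = eqFin⇒≡ (⇒b-elim (forallFin-elim n e y) r)

minimal⇒isMin : ∀ {n} (R : Rel n) {x} → (∀ y → R y x ≡ true → y ≡ x) → isMin R x ≡ true
minimal⇒isMin {n} R f = forallFin-intro n (λ y → ⇒b-intro (λ r → ≡⇒eqFin (f y r)))

¬isMin⇒below : ∀ {n} (R : Rel n) {x} → isMin R x ≡ false → ∃ λ y → R y x ≡ true × (y ≡ x → ⊥)
¬isMin⇒below {n} R e with forallFin-false n e
... | y , e′ = y , proj₁ (⇒b-false e′) , λ y≡x → true≢false (≡⇒eqFin y≡x) (proj₂ (⇒b-false e′))
  where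
  ⇒b-false : ∀ {a b} → (a ⇒b b) ≡ false → a ≡ true × b ≡ false
  ⇒b-false {true} {false} _ = refl , refl

isMin-cong : ∀ {n} {R R′ : Rel n} → R ≋ R′ → ∀ x → isMin R x ≡ isMin R′ x
isMin-cong {n} e x = forallFin-cong n (λ y → cong (_⇒b eqFin y x) (e y x))

isPoset-cong : ∀ {n} {R R′ : Rel n} → R ≋ R′ → isPoset R ≡ isPoset R′
isPoset-cong {n} e = cong₂ _∧_ (forallFin-cong n (λ x → e x x)) (cong₂ _∧_
  (forallFin-cong n (λ x → forallFin-cong n (λ y → cong (_⇒b _) (cong₂ _∧_ (e x y) (e y x)))))
  (forallFin-cong n (λ x → forallFin-cong n (λ y → forallFin-cong n (λ z →
    cong₂ _⇒b_ (cong₂ _∧_ (e x y) (e y z)) (e x z))))))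

isUpset : {n : ℕ} → Rel n → (Fin n → Bool) → Bool
isUpset {n} R U = every n (λ x → every n (λ y → (U x ∧ R x y) ⇒b U y))

isUpset⇒closed : ∀ {n} (R : Rel n) {U} → isUpset R U ≡ true →
  ∀ x y → U x ≡ true → R x y ≡ true → U y ≡ true
isUpset⇒closed {n} R e x y u r = ⇒b-elim (every-elim n (every-elim n e x) y) (∧-intro u r)

closed⇒isUpset : ∀ {n} (R : Rel n) {U} → (∀ x y → U x ≡ true → R x y ≡ true → U y ≡ true) →
  isUpset R U ≡ true
closed⇒isUpset {n} R f = every-intro n (λ x → every-intro n (λ y → ⇒b-intro (λ h →
  let (u , r) = ∧-elim h in f x y u r)))

isUpset-cong : ∀ {n} (R : Rel n) {U U′ : Fin n → Bool} → U ≗ U′ → isUpset R U ≡ isUpset R U′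
isUpset-cong {n} R e = every-cong n (λ x → every-cong n (λ y → cong₂ _⇒b_ (cong (_∧ R x y) (e x)) (e y)))

module BlockTriangular {m k : ℕ} (O : Rel m) (F : Mat m k) (P : Rel k) (R : Rel (m + k))
  (R-ll : ∀ i i′ → R (i ↑ˡ k) (i′ ↑ˡ k) ≡ O i i′)
  (R-lr : ∀ i j → R (i ↑ˡ k) (m ↑ʳ j) ≡ F i j)
  (R-rl : ∀ j i → R (m ↑ʳ j) (i ↑ˡ k) ≡ false)
  (R-rr : ∀ j j′ → R (m ↑ʳ j) (m ↑ʳ j′) ≡ P j j′) where

  private
    absurd-rl : ∀ {j i} {A : Set} → R (m ↑ʳ j) (i ↑ˡ k) ≡ true → A
    absurd-rl {j} {i} r = ⊥-elim (true≢false r (R-rl j i))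

    toO : ∀ {i i′} → R (i ↑ˡ k) (i′ ↑ˡ k) ≡ true → O i i′ ≡ true
    toO {i} {i′} = trans (sym (R-ll i i′))

    toF : ∀ {i j} → R (i ↑ˡ k) (m ↑ʳ j) ≡ true → F i j ≡ true
    toF {i} {j} = trans (sym (R-lr i j))

    toP : ∀ {j j′} → R (m ↑ʳ j) (m ↑ʳ j′) ≡ true → P j j′ ≡ true
    toP {j} {j′} = trans (sym (R-rr j j′))

  R-IsPoset : IsPoset O → IsPoset P →
    (∀ i i′ j → O i i′ ≡ true → F i′ j ≡ true → F i j ≡ true) →
    (∀ i j j′ → F i j ≡ true → P j j′ ≡ true → F i j′ ≡ true) → IsPoset R
  R-IsPoset pO pP F-downˡ F-upʳ = record { refl = reflexive ; antisym = antisymmetric ; trans = transitive }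
    where
    reflexive : ∀ x → R x x ≡ true
    reflexive x with view m k x
    ... | left i = trans (R-ll i i) (IsPoset.refl pO i)
    ... | right j = trans (R-rr j j) (IsPoset.refl pP j)

    antisymmetric : ∀ x y → R x y ≡ true → R y x ≡ true → x ≡ y
    antisymmetric x y r s with view m k x | view m k y
    ... | left i | left i′ = cong (_↑ˡ k) (IsPoset.antisym pO i i′ (toO r) (toO s))
    ... | left i | right j = absurd-rl s
    ... | right j | left i = absurd-rl r
    ... | right j | right j′ = cong (m ↑ʳ_) (IsPoset.antisym pP j j′ (toP r) (toP s))

    transitive : ∀ x y z → R x y ≡ true → R y z ≡ true → R x z ≡ true
    transitive x y z r s with view m k x | view m k y | view m k z
    ... | left i | left i′ | left i″ = trans (R-ll i i″) (IsPoset.trans pO i i′ i″ (toO r) (toO s))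
    ... | left i | left i′ | right j = trans (R-lr i j) (F-downˡ i i′ j (toO r) (toF s))
    ... | left i | right j | left i′ = absurd-rl s
    ... | left i | right j | right j′ = trans (R-lr i j′) (F-upʳ i j j′ (toF r) (toP s))
    ... | right j | left i | _ = absurd-rl r
    ... | right j | right j′ | left i = absurd-rl s
    ... | right j | right j′ | right j″ = trans (R-rr j j″) (IsPoset.trans pP j j′ j″ (toP r) (toP s))

  isMin-↑ˡ : ∀ i → isMin R (i ↑ˡ k) ≡ isMin O i
  isMin-↑ˡ i = ≡-from-⇔ restrict extend
    where
    restrict : isMin R (i ↑ˡ k) ≡ true → isMin O i ≡ true
    restrict μ = minimal⇒isMin O (λ i′ r →
      ↑ˡ-injective k i′ i (isMin⇒minimal R μ (i′ ↑ˡ k) (trans (R-ll i′ i) r)))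

    extend : isMin O i ≡ true → isMin R (i ↑ˡ k) ≡ true
    extend μ = minimal⇒isMin R below
      where
      below : ∀ y → R y (i ↑ˡ k) ≡ true → y ≡ i ↑ˡ k
      below y r with view m k y
      ... | left i′ = cong (_↑ˡ k) (isMin⇒minimal O μ i′ (toO r))
      ... | right j = absurd-rl r

  isMin-↑ʳ : ∀ j → isMin R (m ↑ʳ j) ≡ isMin P j ∧ every m (λ i → not (F i j))
  isMin-↑ʳ j = ≡-from-⇔ restrict extend
    where
    restrict : isMin R (m ↑ʳ j) ≡ true → isMin P j ∧ every m (λ i → not (F i j)) ≡ true
    restrict μ = ∧-intro
      (minimal⇒isMin P (λ j′ r → ↑ʳ-injective m j′ j (isMin⇒minimal R μ (m ↑ʳ j′) (trans (R-rr j′ j) r))))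
      (every-intro m (λ i → ≡false⇒not≡true (Bool.¬-not (λ f →
        ↑ˡ≢↑ʳ i j (isMin⇒minimal R μ (i ↑ˡ k) (trans (R-lr i j) f))))))

    extend : isMin P j ∧ every m (λ i → not (F i j)) ≡ true → isMin R (m ↑ʳ j) ≡ true
    extend h = minimal⇒isMin R below
      where
      below : ∀ y → R y (m ↑ʳ j) ≡ true → y ≡ m ↑ʳ j
      below y r with view m k y
      ... | left i = ⊥-elim (true≢false (toF r) (not≡true⇒≡false (every-elim m (proj₂ (∧-elim h)) i)))
      ... | right j′ = cong (m ↑ʳ_) (isMin⇒minimal P (proj₁ (∧-elim h)) j′ (toP r))

  isUpset-++ : (U : Fin m → Bool) (V : Fin k → Bool) →
    isUpset R (U ++ V) ≡
      (isUpset O U ∧ isUpset P V) ∧ every m (λ i → every k (λ j → (U i ∧ F i j) ⇒b V j))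
  isUpset-++ U V = ≡-from-⇔ restrict extend
    where
    W-l : ∀ i → (U ++ V) (i ↑ˡ k) ≡ U i
    W-l = lookup-++ˡ U V

    W-r : ∀ j → (U ++ V) (m ↑ʳ j) ≡ V j
    W-r = lookup-++ʳ U V

    restrict : isUpset R (U ++ V) ≡ true →
      (isUpset O U ∧ isUpset P V) ∧ every m (λ i → every k (λ j → (U i ∧ F i j) ⇒b V j)) ≡ true
    restrict h = ∧-intro
      (∧-intro
        (closed⇒isUpset O (λ i i′ u r → trans (sym (W-l i′)) (up (trans (W-l i) u) (trans (R-ll i i′) r))))
        (closed⇒isUpset P (λ j j′ v r → trans (sym (W-r j′)) (up (trans (W-r j) v) (trans (R-rr j j′) r)))))
      (every-intro m (λ i → every-intro k (λ j → ⇒b-intro (λ uf →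
        let (u , f) = ∧-elim uf in trans (sym (W-r j)) (up (trans (W-l i) u) (trans (R-lr i j) f))))))
      where
      up : ∀ {x y} → (U ++ V) x ≡ true → R x y ≡ true → (U ++ V) y ≡ true
      up = isUpset⇒closed R h _ _

    extend : (isUpset O U ∧ isUpset P V) ∧ every m (λ i → every k (λ j → (U i ∧ F i j) ⇒b V j)) ≡ true →
      isUpset R (U ++ V) ≡ true
    extend h = closed⇒isUpset R closed
      where
      upO : isUpset O U ≡ true
      upO = proj₁ (∧-elim (proj₁ (∧-elim {isUpset O U ∧ isUpset P V} h)))
      upP : isUpset P V ≡ true
      upP = proj₂ (∧-elim {isUpset O U} (proj₁ (∧-elim {isUpset O U ∧ isUpset P V} h)))
      linked : every m (λ i → every k (λ j → (U i ∧ F i j) ⇒b V j)) ≡ true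
      linked = proj₂ (∧-elim {isUpset O U ∧ isUpset P V} h)

      closed : ∀ x y → (U ++ V) x ≡ true → R x y ≡ true → (U ++ V) y ≡ true
      closed x y w r with view m k x | view m k y
      ... | left i | left i′ = trans (W-l i′) (isUpset⇒closed O upO i i′ (trans (sym (W-l i)) w) (toO r))
      ... | left i | right j =
        trans (W-r j) (⇒b-elim (every-elim k (every-elim m linked i) j) (∧-intro (trans (sym (W-l i)) w) (toF r)))
      ... | right j | left i = absurd-rl r
      ... | right j | right j′ = trans (W-r j′) (isUpset⇒closed P upP j j′ (trans (sym (W-r j)) w) (toP r))

module _ {a b : ℕ} (O : Rel a) (P : Rel b) where

  cardSum-ll : ∀ i i′ → cardSum O P (i ↑ˡ b) (i′ ↑ˡ b) ≡ O i i′
  cardSum-ll i i′ rewrite splitAt-↑ˡ a i b | splitAt-↑ˡ a i′ b = refl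

  cardSum-lr : ∀ i j → cardSum O P (i ↑ˡ b) (a ↑ʳ j) ≡ false
  cardSum-lr i j rewrite splitAt-↑ˡ a i b | splitAt-↑ʳ a b j = refl

  cardSum-rl : ∀ j i → cardSum O P (a ↑ʳ j) (i ↑ˡ b) ≡ false
  cardSum-rl j i rewrite splitAt-↑ʳ a b j | splitAt-↑ˡ a i b = refl

  cardSum-rr : ∀ j j′ → cardSum O P (a ↑ʳ j) (a ↑ʳ j′) ≡ P j j′
  cardSum-rr j j′ rewrite splitAt-↑ʳ a b j | splitAt-↑ʳ a b j′ = refl

  ordSum-ll : ∀ i i′ → ordSum O P (i ↑ˡ b) (i′ ↑ˡ b) ≡ O i i′
  ordSum-ll i i′ rewrite splitAt-↑ˡ a i b | splitAt-↑ˡ a i′ b = refl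

  ordSum-lr : ∀ i j → ordSum O P (i ↑ˡ b) (a ↑ʳ j) ≡ true
  ordSum-lr i j rewrite splitAt-↑ˡ a i b | splitAt-↑ʳ a b j = refl

  ordSum-rl : ∀ j i → ordSum O P (a ↑ʳ j) (i ↑ˡ b) ≡ false
  ordSum-rl j i rewrite splitAt-↑ʳ a b j | splitAt-↑ˡ a i b = refl

  ordSum-rr : ∀ j j′ → ordSum O P (a ↑ʳ j) (a ↑ʳ j′) ≡ P j j′
  ordSum-rr j j′ rewrite splitAt-↑ʳ a b j | splitAt-↑ʳ a b j′ = refl

  module CardinalSum = BlockTriangular O (λ _ _ → false) P (cardSum O P) cardSum-ll cardSum-lr cardSum-rl cardSum-rr
  module OrdinalSum = BlockTriangular O (λ _ _ → true) P (ordSum O P) ordSum-ll ordSum-lr ordSum-rl ordSum-rr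

  cardSum-IsPoset : IsPoset O → IsPoset P → IsPoset (cardSum O P)
  cardSum-IsPoset pO pP = CardinalSum.R-IsPoset pO pP (λ _ _ _ _ ()) (λ _ _ _ ())

  ordSum-IsPoset : IsPoset O → IsPoset P → IsPoset (ordSum O P)
  ordSum-IsPoset pO pP = OrdinalSum.R-IsPoset pO pP (λ _ _ _ _ _ → refl) (λ _ _ _ _ _ → refl)

-- Extensions with a prescribed set of minimal elements

discrete : {n : ℕ} → Rel n
discrete = eqFin

discrete-IsPoset : {n : ℕ} → IsPoset (discrete {n})
discrete-IsPoset = record
  { refl = λ x → ≡⇒eqFin refl
  ; antisym = λ x y r _ → eqFin⇒≡ r
  ; trans = λ x y z r s → ≡⇒eqFin (trans (eqFin⇒≡ r) (eqFin⇒≡ s))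
  }

isMin-discrete : {n : ℕ} (x : Fin n) → isMin discrete x ≡ true
isMin-discrete x = minimal⇒isMin discrete {x} (λ y r → eqFin⇒≡ r)

coversMinimal : (m : ℕ) {k : ℕ} → Rel k → Mat m k → Bool
coversMinimal m {k} P F = every k (λ x → isMin P x ⇒b some m (λ i → F i x))

isUpsetCover : (m : ℕ) {k : ℕ} → Rel k → Mat m k → Bool
isUpsetCover m P F = every m (λ i → isUpset P (F i)) ∧ coversMinimal m P F

blockMatrix : {m k : ℕ} → Mat m m → Mat m k → Mat k m → Mat k k → Rel (m + k)
blockMatrix A F C D = (λ i → A i ++ F i) ++ (λ j → C j ++ D j)

module _ (m : ℕ) {k : ℕ} (P : Rel k) (A : Mat m m) (F : Mat m k) (C : Mat k m) (D : Mat k k) where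

  private
    Q : Rel (m + k)
    Q = blockMatrix A F C D

    Q-ll : ∀ i i′ → Q (i ↑ˡ k) (i′ ↑ˡ k) ≡ A i i′
    Q-ll i i′ rewrite splitAt-↑ˡ m i k | splitAt-↑ˡ m i′ k = refl

    Q-lr : ∀ i j → Q (i ↑ˡ k) (m ↑ʳ j) ≡ F i j
    Q-lr i j rewrite splitAt-↑ˡ m i k | splitAt-↑ʳ m k j = refl

    Q-rl : ∀ j i → Q (m ↑ʳ j) (i ↑ˡ k) ≡ C j i
    Q-rl j i rewrite splitAt-↑ʳ m k j | splitAt-↑ˡ m i k = refl

    Q-rr : ∀ j j′ → Q (m ↑ʳ j) (m ↑ʳ j′) ≡ D j j′
    Q-rr j j′ rewrite splitAt-↑ʳ m k j | splitAt-↑ʳ m k j′ = refl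

  -- A, F, C, D are the blocks M × M, M × K, K × M, K × K of a relation on M ⊎ K.
  extensionBlocks : Bool
  extensionBlocks = ((matEq A discrete ∧ isUpsetCover m P F) ∧ matEq C (λ _ _ → false)) ∧ matEq D P

  private
    extensionBlocks-intro : A ≋ discrete → isUpsetCover m P F ≡ true → C ≋ (λ _ _ → false) → D ≋ P →
      extensionBlocks ≡ true
    extensionBlocks-intro a f c d =
      ∧-intro (∧-intro (∧-intro (matEq-intro a) f) (matEq-intro c)) (matEq-intro d)

    extensionBlocks-elim : extensionBlocks ≡ true →
      A ≋ discrete × isUpsetCover m P F ≡ true × C ≋ (λ _ _ → false) × D ≋ P
    extensionBlocks-elim blocks with matEq A discrete in a | isUpsetCover m P F
                                   | matEq C (λ _ _ → false) in c | matEq D P in d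
    extensionBlocks-elim refl | true | true | true | true =
      matEq-elim a , refl , matEq-elim c , matEq-elim {M = D} d

    isExtension-elim : isExtension m P Q ≡ true →
      isPoset Q ≡ true × (∀ j j′ → Q (m ↑ʳ j) (m ↑ʳ j′) ≡ P j j′) × (∀ x → isMin Q x ≡ inM {m} {k} x)
    isExtension-elim ext with ∧-elim {isPoset Q} ext
    ... | poset , rest with ∧-elim {forallFin k (λ j → forallFin k (λ j′ → Q (m ↑ʳ j) (m ↑ʳ j′) ⇔b P j j′))} rest
    ... | induced , minimal =
      poset ,
      (λ j j′ → ⇔b-elim (forallFin-elim k (forallFin-elim k induced j) j′)) ,
      (λ x → ⇔b-elim (forallFin-elim (m + k) minimal x))

  isExtension⇒extensionBlocks : isExtension m P (blockMatrix A F C D) ≡ true → extensionBlocks ≡ true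
  isExtension⇒extensionBlocks ext =
    extensionBlocks-intro A-discrete (∧-intro (every-intro m F-upset) (every-intro k covered)) C-false D-induced
    where
    isPosetQ : IsPoset Q
    isPosetQ = isPoset⇒IsPoset Q (proj₁ (isExtension-elim ext))

    induced : ∀ j j′ → Q (m ↑ʳ j) (m ↑ʳ j′) ≡ P j j′
    induced = proj₁ (proj₂ (isExtension-elim ext))

    minimal≡inM : ∀ x → isMin Q x ≡ inM {m} {k} x
    minimal≡inM = proj₂ (proj₂ (isExtension-elim ext))

    below-left : ∀ i y → Q y (i ↑ˡ k) ≡ true → y ≡ i ↑ˡ k
    below-left i = isMin⇒minimal Q (trans (minimal≡inM (i ↑ˡ k)) (inM-↑ˡ i))

    A-discrete : A ≋ discrete
    A-discrete i i′ = ≡-from-⇔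
      (λ r → ≡⇒eqFin (↑ˡ-injective k i i′ (below-left i′ _ (trans (Q-ll i i′) r))))
      (λ r → subst (λ w → A i w ≡ true) (eqFin⇒≡ r) (trans (sym (Q-ll i i)) (IsPoset.refl isPosetQ _)))

    C-false : C ≋ (λ _ _ → false)
    C-false j i = Bool.¬-not (λ r → ↑ˡ≢↑ʳ i j (sym (below-left i _ (trans (Q-rl j i) r))))

    D-induced : D ≋ P
    D-induced j j′ = trans (sym (Q-rr j j′)) (induced j j′)

    F-upset : ∀ i → isUpset P (F i) ≡ true
    F-upset i = closed⇒isUpset P (λ x y f r → trans (sym (Q-lr i y))
      (IsPoset.trans isPosetQ _ _ _ (trans (Q-lr i x) f) (trans (induced x y) r)))

    covered : ∀ x → (isMin P x ⇒b some m (λ i → F i x)) ≡ true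
    covered x = ⇒b-intro (λ μ → lower μ (¬isMin⇒below Q (trans (minimal≡inM (m ↑ʳ x)) (inM-↑ʳ x))))
      where
      lower : isMin P x ≡ true → (∃ λ y → Q y (m ↑ʳ x) ≡ true × (y ≡ m ↑ʳ x → ⊥)) →
        some m (λ i → F i x) ≡ true
      lower μ (y , r , y≢x) with view m k y
      ... | left i = some-intro m i (trans (sym (Q-lr i x)) r)
      ... | right j = ⊥-elim (y≢x (cong (m ↑ʳ_) (isMin⇒minimal P μ j (trans (sym (induced j x)) r))))

  extensionBlocks⇒isExtension : IsPoset P → extensionBlocks ≡ true → isExtension m P (blockMatrix A F C D) ≡ true
  extensionBlocks⇒isExtension pP blocks =
    ∧-intro (IsPoset⇒isPoset Q isPosetQ)
      (∧-intro (forallFin-intro k (λ j → forallFin-intro k (λ j′ → ⇔b-intro (Q-P j j′))))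
        (forallFin-intro (m + k) (λ x → ⇔b-intro (minimal≡inM x))))
    where
    A-discrete : A ≋ discrete
    A-discrete = proj₁ (extensionBlocks-elim blocks)

    cover : isUpsetCover m P F ≡ true
    cover = proj₁ (proj₂ (extensionBlocks-elim blocks))

    C-false : C ≋ (λ _ _ → false)
    C-false = proj₁ (proj₂ (proj₂ (extensionBlocks-elim blocks)))

    Q-P : ∀ j j′ → Q (m ↑ʳ j) (m ↑ʳ j′) ≡ P j j′
    Q-P j j′ = trans (Q-rr j j′) (proj₂ (proj₂ (proj₂ (extensionBlocks-elim blocks))) j j′)

    open BlockTriangular discrete F P Q
      (λ i i′ → trans (Q-ll i i′) (A-discrete i i′)) Q-lr (λ j i → trans (Q-rl j i) (C-false j i)) Q-P

    F-upset : ∀ i → isUpset P (F i) ≡ true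
    F-upset = every-elim m (proj₁ (∧-elim {every m (λ i → isUpset P (F i))} cover))

    isPosetQ : IsPoset Q
    isPosetQ = R-IsPoset discrete-IsPoset pP
      (λ i i′ j r f → subst (λ w → F w j ≡ true) (sym (eqFin⇒≡ r)) f)
      (λ i j j′ → isUpset⇒closed P (F-upset i) j j′)

    minimal≡inM : ∀ x → isMin Q x ≡ inM {m} {k} x
    minimal≡inM x with view m k x
    ... | left i = trans (isMin-↑ˡ i) (trans (isMin-discrete i) (sym (inM-↑ˡ i)))
    ... | right j = trans (isMin-↑ʳ j) (trans (uncovered (isMin P j) refl) (sym (inM-↑ʳ j)))
      where
      uncovered : ∀ μ → isMin P j ≡ μ → μ ∧ every m (λ i → not (F i j)) ≡ false
      uncovered false _ = refl
      uncovered true μ = not≡true⇒≡false (trans (sym (some≡not-every-not m (λ i → F i j)))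
        (⇒b-elim (every-elim k (proj₂ (∧-elim {every m (λ i → isUpset P (F i))} cover)) j) μ))

  isExtension-blockMatrix : IsPoset P → isExtension m P (blockMatrix A F C D) ≡ extensionBlocks
  isExtension-blockMatrix pP = ≡-from-⇔ isExtension⇒extensionBlocks (extensionBlocks⇒isExtension pP)

isExtension-cong : ∀ m {k} (P : Rel k) {Q Q′ : Rel (m + k)} → Q ≋ Q′ →
  isExtension m P Q ≡ isExtension m P Q′
isExtension-cong m {k} P e = cong₂ _∧_ (isPoset-cong e) (cong₂ _∧_
  (forallFin-cong k (λ i → forallFin-cong k (λ j → cong (_⇔b P i j) (e _ _))))
  (forallFin-cong (m + k) (λ x → cong (_⇔b inM {m} {k} x) (isMin-cong e x))))

isUpsetCover-cong : ∀ m {k} (P : Rel k) {F F′ : Mat m k} → F ≋ F′ → isUpsetCover m P F ≡ isUpsetCover m P F′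
isUpsetCover-cong m {k} P e = cong₂ _∧_ (every-cong m (λ i → isUpset-cong P (e i)))
  (every-cong k (λ x → cong (isMin P x ⇒b_) (some-cong m (λ i → e i x))))

∑Mat-blocks : (m k : ℕ) {G : Rel (m + k) → ℤ} → Respects≋ G →
  ∑Mat (m + k) (m + k) G ≡
    ∑Mat m m (λ A → ∑Mat m k (λ F → ∑Mat k m (λ C → ∑Mat k k (λ D → G (blockMatrix A F C D)))))
∑Mat-blocks m k {G} resp = begin
  ∑Mat (m + k) (m + k) G
    ≡⟨ ∑Fns-++ m k (allSubsets (m + k)) (λ e → resp (λ i → cong-app (e i))) ⟩
  ∑Mat m (m + k) (λ T → ∑Mat k (m + k) (λ U → G (T ++ U)))
    ≡⟨ ∑Mat-++ m m k (λ e → ∑-cong (allFns k (allSubsets (m + k))) (λ U → resp (++-cong≋ e λ _ _ → refl))) ⟩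
  ∑Mat m m (λ A → ∑Mat m k (λ F → ∑Mat k (m + k) (λ U → G ((λ i → A i ++ F i) ++ U))))
    ≡⟨ ∑-cong (allFns m (allSubsets m)) (λ A → ∑-cong (allFns m (allSubsets k)) (λ F →
         ∑Mat-++ k m k (λ e → resp (++-cong≋ (λ _ _ → refl) e)))) ⟩
  ∑Mat m m (λ A → ∑Mat m k (λ F → ∑Mat k m (λ C → ∑Mat k k (λ D → G (blockMatrix A F C D))))) ∎
  where open ≡-Reasoning

∑Mat-extensionBlocks : (m : ℕ) {k : ℕ} (P : Rel k) →
  ∑Mat m m (λ A → ∑Mat m k (λ F → ∑Mat k m (λ C → ∑Mat k k (λ D → 𝟙 (extensionBlocks m P A F C D)))))
    ≡ ∑Mat m k (𝟙 ∘ isUpsetCover m P)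
∑Mat-extensionBlocks m {k} P = begin
  ∑Mat m m (λ A → ∑Mat m k (λ F → ∑Mat k m (λ C → ∑Mat k k (λ D → 𝟙 (extensionBlocks m P A F C D)))))
    ≡⟨ ∑-cong (allFns m (allSubsets m)) (λ A → ∑-cong (allFns m (allSubsets k)) (λ F →
         ∑-cong (allFns k (allSubsets m)) (λ C → ∑-cong (allFns k (allSubsets k)) (λ D → 𝟙-blocks A F C D)))) ⟩
  ∑Mat m m (λ A → ∑Mat m k (λ F → ∑Mat k m (λ C → ∑Mat k k (λ D →
    ((𝟙 (matEq A discrete) *ℤ 𝟙 (isUpsetCover m P F)) *ℤ 𝟙 (matEq C ∅)) *ℤ 𝟙 (matEq D P)))))
    ≡⟨ ∑-cong (allFns m (allSubsets m)) (λ A → ∑-cong (allFns m (allSubsets k)) (λ F →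
         ∑-cong (allFns k (allSubsets m)) (λ C → ∑-*-unit (allFns k (allSubsets k))
           ((𝟙 (matEq A discrete) *ℤ 𝟙 (isUpsetCover m P F)) *ℤ 𝟙 (matEq C ∅)) (∑Mat-matEq k k P)))) ⟩
  ∑Mat m m (λ A → ∑Mat m k (λ F → ∑Mat k m (λ C →
    (𝟙 (matEq A discrete) *ℤ 𝟙 (isUpsetCover m P F)) *ℤ 𝟙 (matEq C ∅))))
    ≡⟨ ∑-cong (allFns m (allSubsets m)) (λ A → ∑-cong (allFns m (allSubsets k)) (λ F →
         ∑-*-unit (allFns k (allSubsets m))
           (𝟙 (matEq A discrete) *ℤ 𝟙 (isUpsetCover m P F)) (∑Mat-matEq k m ∅))) ⟩
  ∑Mat m m (λ A → ∑Mat m k (λ F → 𝟙 (matEq A discrete) *ℤ 𝟙 (isUpsetCover m P F)))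
    ≡⟨ ∑∑-* (allFns m (allSubsets m)) (allFns m (allSubsets k)) (λ A → 𝟙 (matEq A discrete)) (𝟙 ∘ isUpsetCover m P) ⟩
  ∑Mat m m (λ A → 𝟙 (matEq A discrete)) *ℤ ∑Mat m k (𝟙 ∘ isUpsetCover m P)
    ≡⟨ cong (_*ℤ ∑Mat m k (𝟙 ∘ isUpsetCover m P)) (∑Mat-matEq m m discrete) ⟩
  1ℤ *ℤ ∑Mat m k (𝟙 ∘ isUpsetCover m P)
    ≡⟨ ℤ.*-identityˡ _ ⟩
  ∑Mat m k (𝟙 ∘ isUpsetCover m P) ∎
  where
  open ≡-Reasoning
  ∅ : Mat k m
  ∅ _ _ = false

  𝟙-blocks : ∀ A F C D → 𝟙 (extensionBlocks m P A F C D) ≡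
    ((𝟙 (matEq A discrete) *ℤ 𝟙 (isUpsetCover m P F)) *ℤ 𝟙 (matEq C ∅)) *ℤ 𝟙 (matEq D P)
  𝟙-blocks A F C D rewrite 𝟙-∧ ((matEq A discrete ∧ isUpsetCover m P F) ∧ matEq C ∅) (matEq D P)
    | 𝟙-∧ (matEq A discrete ∧ isUpsetCover m P F) (matEq C ∅) | 𝟙-∧ (matEq A discrete) (isUpsetCover m P F) = refl

e≡∑upsetCovers : (m : ℕ) {k : ℕ} (P : Rel k) → IsPoset P →
  + e m P ≡ ∑Mat m k (𝟙 ∘ isUpsetCover m P)
e≡∑upsetCovers m {k} P pP = begin
  + e m P
    ≡⟨ count≡∑𝟙 (isExtension m P) (allRels (m + k)) ⟩
  ∑Mat (m + k) (m + k) (𝟙 ∘ isExtension m P)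
    ≡⟨ ∑Mat-blocks m k (λ e → cong 𝟙 (isExtension-cong m P e)) ⟩
  ∑Mat m m (λ A → ∑Mat m k (λ F → ∑Mat k m (λ C → ∑Mat k k (λ D →
    𝟙 (isExtension m P (blockMatrix A F C D))))))
    ≡⟨ ∑-cong (allFns m (allSubsets m)) (λ A → ∑-cong (allFns m (allSubsets k)) (λ F →
         ∑-cong (allFns k (allSubsets m)) (λ C → ∑-cong (allFns k (allSubsets k)) (λ D →
           cong 𝟙 (isExtension-blockMatrix m P A F C D pP))))) ⟩
  ∑Mat m m (λ A → ∑Mat m k (λ F → ∑Mat k m (λ C → ∑Mat k k (λ D → 𝟙 (extensionBlocks m P A F C D)))))
    ≡⟨ ∑Mat-extensionBlocks m P ⟩
  ∑Mat m k (𝟙 ∘ isUpsetCover m P) ∎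
  where open ≡-Reasoning

-- Cardinal sums

module _ {a b : ℕ} (O : Rel a) (P : Rel b) where

  isUpset-cardSum : (U : Fin a → Bool) (V : Fin b → Bool) →
    isUpset (cardSum O P) (U ++ V) ≡ isUpset O U ∧ isUpset P V
  isUpset-cardSum U V = begin
    isUpset (cardSum O P) (U ++ V)
      ≡⟨ CardinalSum.isUpset-++ O P U V ⟩
    (isUpset O U ∧ isUpset P V) ∧ every a (λ i → every b (λ j → (U i ∧ false) ⇒b V j))
      ≡⟨ cong ((isUpset O U ∧ isUpset P V) ∧_) unlinked ⟩
    (isUpset O U ∧ isUpset P V) ∧ true
      ≡⟨ Bool.∧-identityʳ _ ⟩
    isUpset O U ∧ isUpset P V ∎
    where
    open ≡-Reasoning
    unlinked : every a (λ i → every b (λ j → (U i ∧ false) ⇒b V j)) ≡ true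
    unlinked = every-intro a (λ i → every-intro b (λ j → ⇒b-intro (λ h → ⊥-elim (true≢false h (Bool.∧-zeroʳ (U i))))))

  isMin-cardSum-↑ʳ : ∀ j → isMin (cardSum O P) (a ↑ʳ j) ≡ isMin P j
  isMin-cardSum-↑ʳ j =
    trans (CardinalSum.isMin-↑ʳ O P j) (trans (cong (isMin P j ∧_) (every-true a)) (Bool.∧-identityʳ _))

  isUpsetCover-cardSum : (m : ℕ) (F₁ : Mat m a) (F₂ : Mat m b) →
    isUpsetCover m (cardSum O P) (λ i → F₁ i ++ F₂ i) ≡ isUpsetCover m O F₁ ∧ isUpsetCover m P F₂
  isUpsetCover-cardSum m F₁ F₂ = begin
    isUpsetCover m (cardSum O P) (λ i → F₁ i ++ F₂ i)
      ≡⟨ cong₂ _∧_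
           (trans (every-cong m (λ i → isUpset-cardSum (F₁ i) (F₂ i)))
             (every-∧ m (λ i → isUpset O (F₁ i)) (λ i → isUpset P (F₂ i))))
           (trans (every-++ a b _) (cong₂ _∧_
             (every-cong a (λ x → cong₂ _⇒b_ (CardinalSum.isMin-↑ˡ O P x)
               (some-cong m (λ i → lookup-++ˡ (F₁ i) (F₂ i) x))))
             (every-cong b (λ x → cong₂ _⇒b_ (isMin-cardSum-↑ʳ x)
               (some-cong m (λ i → lookup-++ʳ (F₁ i) (F₂ i) x)))))) ⟩
    (up₁ ∧ up₂) ∧ (cov₁ ∧ cov₂)
      ≡⟨ interchange up₁ up₂ cov₁ cov₂ ⟩
    (up₁ ∧ cov₁) ∧ (up₂ ∧ cov₂) ∎
    where
    open ≡-Reasoning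
    up₁ up₂ cov₁ cov₂ : Bool
    up₁ = every m (λ i → isUpset O (F₁ i))
    up₂ = every m (λ i → isUpset P (F₂ i))
    cov₁ = coversMinimal m O F₁
    cov₂ = coversMinimal m P F₂
    interchange : ∀ w x y z → (w ∧ x) ∧ (y ∧ z) ≡ (w ∧ y) ∧ (x ∧ z)
    interchange true true y z = refl
    interchange true false y z = sym (Bool.∧-zeroʳ y)
    interchange false x y z = refl

  e-cardSum : IsPoset O → IsPoset P → (m : ℕ) → e m (cardSum O P) ≡ e m O * e m P
  e-cardSum pO pP m = ℤ.+-injective (begin
    + e m (cardSum O P)
      ≡⟨ e≡∑upsetCovers m (cardSum O P) (cardSum-IsPoset O P pO pP) ⟩
    ∑Mat m (a + b) (𝟙 ∘ isUpsetCover m (cardSum O P))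
      ≡⟨ ∑Mat-++ m a b (λ e → cong 𝟙 (isUpsetCover-cong m (cardSum O P) e)) ⟩
    ∑Mat m a (λ F₁ → ∑Mat m b (λ F₂ → 𝟙 (isUpsetCover m (cardSum O P) (λ i → F₁ i ++ F₂ i))))
      ≡⟨ ∑-cong (allFns m (allSubsets a)) (λ F₁ → ∑-cong (allFns m (allSubsets b)) (λ F₂ →
           trans (cong 𝟙 (isUpsetCover-cardSum m F₁ F₂)) (𝟙-∧ (isUpsetCover m O F₁) _))) ⟩
    ∑Mat m a (λ F₁ → ∑Mat m b (λ F₂ → 𝟙 (isUpsetCover m O F₁) *ℤ 𝟙 (isUpsetCover m P F₂)))
      ≡⟨ ∑∑-* (allFns m (allSubsets a)) (allFns m (allSubsets b)) _ _ ⟩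
    ∑Mat m a (𝟙 ∘ isUpsetCover m O) *ℤ ∑Mat m b (𝟙 ∘ isUpsetCover m P)
      ≡⟨ cong₂ _*ℤ_ (e≡∑upsetCovers m O pO) (e≡∑upsetCovers m P pP) ⟨
    + e m O *ℤ + e m P
      ≡⟨ ℤ.pos-* (e m O) (e m P) ⟨
    + (e m O * e m P) ∎)
    where open ≡-Reasoning

-- Ordinal sums

avoids : {n : ℕ} → (Fin n → Bool) → (Fin n → Bool) → Bool
avoids {n} B U = every n (λ x → B x ⇒b not (U x))

module _ {n : ℕ} (O : Rel n) (B : Fin n → Bool) (B-minimal : ∀ x → B x ≡ true → isMin O x ≡ true) where

  complementOutside : (Fin n → Bool) → Fin n → Bool
  complementOutside S x = not (B x) xor S x

  private
    inside : ∀ S x → B x ≡ true → complementOutside S x ≡ S x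
    inside S x b rewrite b = refl

    outside : ∀ S x → B x ≡ false → complementOutside S x ≡ not (S x)
    outside S x b rewrite b = refl

  upset∧avoids⇒downset : (S : Fin n → Bool) →
    isUpset O (complementOutside S) ∧ avoids B (complementOutside S) ≡ true → isDownsetOn O (not ∘ B) S ≡ true
  upset∧avoids⇒downset S h = ∧-intro
    (forallFin-intro n (λ x → ⇒b-intro (λ s → ≡false⇒not≡true (S-outside x s))))
    (forallFin-intro n (λ x → forallFin-intro n (λ y → ⇒b-intro (λ h′ →
      let (s , rest) = ∧-elim {S x} h′ ; (nb , r) = ∧-elim {not (B y)} rest
      in S-down x y s (not≡true⇒≡false nb) r))))
    where
    up : isUpset O (complementOutside S) ≡ true
    up = proj₁ (∧-elim {isUpset O (complementOutside S)} h)

    S-outside : ∀ x → S x ≡ true → B x ≡ false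
    S-outside x s = Bool.¬-not (λ b → true≢false (trans (inside S x b) s)
      (not≡true⇒≡false (⇒b-elim (every-elim n (proj₂ (∧-elim {isUpset O (complementOutside S)} h)) x) b)))

    S-down : ∀ x y → S x ≡ true → B y ≡ false → O y x ≡ true → S y ≡ true
    S-down x y s b r with S y in sy
    ... | true = refl
    ... | false = ⊥-elim (true≢false
      (isUpset⇒closed O up y x (trans (outside S y b) (≡false⇒not≡true sy)) r)
      (trans (outside S x (S-outside x s)) (cong not s)))

  -- As B ⊆ Min O, nothing outside B lies below B, so upsets of O − B are still upsets of O.
  downset⇒upset∧avoids : (S : Fin n → Bool) →
    isDownsetOn O (not ∘ B) S ≡ true → isUpset O (complementOutside S) ∧ avoids B (complementOutside S) ≡ true
  downset⇒upset∧avoids S h = ∧-intro (closed⇒isUpset O closed)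
    (every-intro n (λ x → ⇒b-intro (λ b → ≡false⇒not≡true (trans (inside S x b) (S-outside x b)))))
    where
    S⊆outside : forallFin n (λ x → S x ⇒b not (B x)) ≡ true
    S⊆outside = proj₁ (∧-elim {forallFin n (λ x → S x ⇒b not (B x))} h)

    S-down : ∀ y x → S y ≡ true → not (B x) ∧ O x y ≡ true → S x ≡ true
    S-down y x s r = ⇒b-elim (forallFin-elim n (forallFin-elim n
      (proj₂ (∧-elim {forallFin n (λ x → S x ⇒b not (B x))} h)) y) x) (∧-intro s r)

    S-outside : ∀ x → B x ≡ true → S x ≡ false
    S-outside x b = Bool.¬-not (λ s → true≢false b (not≡true⇒≡false (⇒b-elim (forallFin-elim n S⊆outside x) s)))

    closed : ∀ x y → complementOutside S x ≡ true → O x y ≡ true → complementOutside S y ≡ true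
    closed x y u r with B x in bx
    ... | true = ⊥-elim (true≢false u (S-outside x bx))
    ... | false with B y in by
    ... | true = ⊥-elim (true≢false (subst (λ w → B w ≡ true) (sym (isMin⇒minimal O (B-minimal y by) x r)) by) bx)
    ... | false with S y in sy
    ... | false = refl
    ... | true = ⊥-elim (true≢false (S-down y x sy (∧-intro (≡false⇒not≡true bx) r)) (not≡true⇒≡false u))

  isUpset∧avoids≡isDownsetOn : (S : Fin n → Bool) →
    isUpset O (complementOutside S) ∧ avoids B (complementOutside S) ≡ isDownsetOn O (not ∘ B) S
  isUpset∧avoids≡isDownsetOn S = ≡-from-⇔ (upset∧avoids⇒downset S) (downset⇒upset∧avoids S)

  ∑upsetsAvoiding≡dOn : ∑Subsets n (λ U → 𝟙 (isUpset O U ∧ avoids B U)) ≡ + dOn O (not ∘ B)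
  ∑upsetsAvoiding≡dOn = begin
    ∑Subsets n (λ U → 𝟙 (isUpset O U ∧ avoids B U))
      ≡⟨ ∑Subsets-xor n (not ∘ B) (λ e → cong 𝟙 (cong₂ _∧_ (isUpset-cong O e)
           (every-cong n (λ x → cong (λ w → B x ⇒b not w) (e x))))) ⟩
    ∑Subsets n (λ S → 𝟙 (isUpset O (complementOutside S) ∧ avoids B (complementOutside S)))
      ≡⟨ ∑-cong (allSubsets n) (λ S → cong 𝟙 (isUpset∧avoids≡isDownsetOn S)) ⟩
    ∑Subsets n (𝟙 ∘ isDownsetOn O (not ∘ B))
      ≡⟨ count≡∑𝟙 _ (allSubsets n) ⟨
    + dOn O (not ∘ B) ∎
    where open ≡-Reasoning

∑upsets≡d : ∀ {n} (P : Rel n) → ∑Subsets n (𝟙 ∘ isUpset P) ≡ + d P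
∑upsets≡d {n} P = trans
  (∑-cong (allSubsets n) (λ U → cong 𝟙 (sym (trans (cong (isUpset P U ∧_) (every-true n)) (Bool.∧-identityʳ _)))))
  (∑upsetsAvoiding≡dOn P (λ _ → false) (λ _ ()))

module _ {a b : ℕ} (O : Rel a) (P : Rel b) where

  ordSum-link : (U₁ : Fin a → Bool) (U₂ : Fin b → Bool) →
    every a (λ i → every b (λ j → (U₁ i ∧ true) ⇒b U₂ j)) ≡ every a (not ∘ U₁) ∨ every b U₂
  ordSum-link U₁ U₂ = ≡-from-⇔ emptyOrFull linked
    where
    emptyOrFull : every a (λ i → every b (λ j → (U₁ i ∧ true) ⇒b U₂ j)) ≡ true →
      every a (not ∘ U₁) ∨ every b U₂ ≡ true
    emptyOrFull h with every a (not ∘ U₁) in empty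
    ... | true = refl
    ... | false with every-false a empty
    ... | i , u = every-intro b (λ j → ⇒b-elim (every-elim b (every-elim a h i) j) (∧-intro (not-false u) refl))
      where
      not-false : ∀ {x} → not x ≡ false → x ≡ true
      not-false {true} _ = refl

    linked : every a (not ∘ U₁) ∨ every b U₂ ≡ true → every a (λ i → every b (λ j → (U₁ i ∧ true) ⇒b U₂ j)) ≡ true
    linked h with ∨-elim {every a (not ∘ U₁)} h
    ... | inj₁ empty = every-intro a (λ i → every-intro b (λ j → ⇒b-intro (λ u →
      ⊥-elim (true≢false (proj₁ (∧-elim u)) (not≡true⇒≡false (every-elim a empty i))))))
    ... | inj₂ full = every-intro a (λ i → every-intro b (λ j → ⇒b-intro (λ _ → every-elim b full j)))

  -- An upset of O ⊕ P is an upset of P (U₁ = ∅) or an upset of O together with all of P (U₂ full).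
  𝟙-ordSum-upset-avoiding : (B U₁ : Fin a → Bool) (U₂ : Fin b → Bool) →
    𝟙 (isUpset (ordSum O P) (U₁ ++ U₂) ∧ avoids B U₁) ≡
      (𝟙 (isUpset O U₁ ∧ avoids B U₁) *ℤ 𝟙 (every b U₂) +ℤ 𝟙 (every a (not ∘ U₁)) *ℤ 𝟙 (isUpset P U₂))
        -ℤ 𝟙 (every a (not ∘ U₁)) *ℤ 𝟙 (every b U₂)
  𝟙-ordSum-upset-avoiding B U₁ U₂ = begin
    𝟙 (isUpset (ordSum O P) (U₁ ++ U₂) ∧ avoids B U₁)
      ≡⟨ cong (λ w → 𝟙 (w ∧ avoids B U₁))
           (trans (OrdinalSum.isUpset-++ O P U₁ U₂) (cong ((isUpset O U₁ ∧ isUpset P U₂) ∧_) (ordSum-link U₁ U₂))) ⟩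
    𝟙 (((isUpset O U₁ ∧ isUpset P U₂) ∧ (every a (not ∘ U₁) ∨ every b U₂)) ∧ avoids B U₁)
      ≡⟨ cong 𝟙 (∧-shuffle (isUpset O U₁) (isUpset P U₂) _ (avoids B U₁)) ⟩
    𝟙 (((isUpset O U₁ ∧ avoids B U₁) ∧ isUpset P U₂) ∧ (every a (not ∘ U₁) ∨ every b U₂))
      ≡⟨ 𝟙-inclusion–exclusion _ _ _ _ empty⇒upset-avoiding full⇒upset ⟩
    (𝟙 (isUpset O U₁ ∧ avoids B U₁) *ℤ 𝟙 (every b U₂) +ℤ 𝟙 (every a (not ∘ U₁)) *ℤ 𝟙 (isUpset P U₂))
      -ℤ 𝟙 (every a (not ∘ U₁)) *ℤ 𝟙 (every b U₂) ∎
    where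
    open ≡-Reasoning
    empty⇒upset-avoiding : every a (not ∘ U₁) ≡ true → isUpset O U₁ ∧ avoids B U₁ ≡ true
    empty⇒upset-avoiding empty = ∧-intro
      (closed⇒isUpset O (λ x _ u _ → ⊥-elim (true≢false u (not≡true⇒≡false (every-elim a empty x)))))
      (every-intro a (λ x → ⇒b-intro (λ _ → every-elim a empty x)))

    full⇒upset : every b U₂ ≡ true → isUpset P U₂ ≡ true
    full⇒upset full = closed⇒isUpset P (λ _ y _ _ → every-elim b full y)

module _ {a b : ℕ} (O : Rel a) (P : Rel b) where

  ∑upsetsAvoiding-ordSum : (B : Fin a → Bool) → (∀ x → B x ≡ true → isMin O x ≡ true) →
    ∑Subsets (a + b) (λ U → 𝟙 (isUpset (ordSum O P) U ∧ avoids B (λ x → U (x ↑ˡ b))))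
      ≡ (+ dOn O (not ∘ B) +ℤ + d P) -ℤ 1ℤ
  ∑upsetsAvoiding-ordSum B B-minimal = begin
    ∑Subsets (a + b) (λ U → 𝟙 (isUpset R U ∧ avoids B (λ x → U (x ↑ˡ b))))
      ≡⟨ ∑Fns-++ a b bools (λ e → cong 𝟙 (cong₂ _∧_ (isUpset-cong R e)
           (every-cong a (λ x → cong (λ w → B x ⇒b not w) (e (x ↑ˡ b)))))) ⟩
    ∑Subsets a (λ U₁ → ∑Subsets b (λ U₂ → 𝟙 (isUpset R (U₁ ++ U₂) ∧ avoids B (λ x → (U₁ ++ U₂) (x ↑ˡ b)))))
      ≡⟨ ∑-cong (allSubsets a) (λ U₁ → ∑-cong (allSubsets b) (λ U₂ →
           trans (cong (λ w → 𝟙 (isUpset R (U₁ ++ U₂) ∧ w))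
                   (every-cong a (λ x → cong (λ w → B x ⇒b not w) (lookup-++ˡ U₁ U₂ x))))
                 (𝟙-ordSum-upset-avoiding O P B U₁ U₂))) ⟩
    ∑Subsets a (λ U₁ → ∑Subsets b (λ U₂ →
      (𝟙 (isUpset O U₁ ∧ avoids B U₁) *ℤ 𝟙 (every b U₂) +ℤ 𝟙 (every a (not ∘ U₁)) *ℤ 𝟙 (isUpset P U₂))
        -ℤ 𝟙 (every a (not ∘ U₁)) *ℤ 𝟙 (every b U₂)))
      ≡⟨ ∑∑-linear (allSubsets a) (allSubsets b) _ _ _ _ _ _ ⟩
    (∑Subsets a (λ U₁ → 𝟙 (isUpset O U₁ ∧ avoids B U₁)) *ℤ ∑Subsets b (λ U₂ → 𝟙 (every b U₂))
      +ℤ ∑Subsets a (λ U₁ → 𝟙 (every a (not ∘ U₁))) *ℤ ∑Subsets b (𝟙 ∘ isUpset P))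
      -ℤ ∑Subsets a (λ U₁ → 𝟙 (every a (not ∘ U₁))) *ℤ ∑Subsets b (λ U₂ → 𝟙 (every b U₂))
      ≡⟨ cong₂ _-ℤ_
           (cong₂ _+ℤ_ (cong₂ _*ℤ_ (∑upsetsAvoiding≡dOn O B B-minimal) (∑Subsets-full b))
                       (cong₂ _*ℤ_ (∑Subsets-empty a) (∑upsets≡d P)))
           (cong₂ _*ℤ_ (∑Subsets-empty a) (∑Subsets-full b)) ⟩
    (+ dOn O (not ∘ B) *ℤ 1ℤ +ℤ 1ℤ *ℤ + d P) -ℤ 1ℤ *ℤ 1ℤ
      ≡⟨ simplify (+ dOn O (not ∘ B)) (+ d P) ⟩
    (+ dOn O (not ∘ B) +ℤ + d P) -ℤ 1ℤ ∎
    where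
    open ≡-Reasoning
    R : Rel (a + b)
    R = ordSum O P
    simplify : ∀ x y → (x *ℤ 1ℤ +ℤ 1ℤ *ℤ y) -ℤ 1ℤ *ℤ 1ℤ ≡ (x +ℤ y) -ℤ 1ℤ
    simplify = solve-∀

sumFrom1-cong : ∀ D {f g : ℕ → ℤ} → (∀ j → f j ≡ g j) → sumFrom1 D f ≡ sumFrom1 D g
sumFrom1-cong zero e = refl
sumFrom1-cong (suc D) e = cong₂ _+ℤ_ (sumFrom1-cong D e) (e (suc D))

sumFrom1-zero : ∀ D → sumFrom1 D (λ _ → 0ℤ) ≡ 0ℤ
sumFrom1-zero zero = refl
sumFrom1-zero (suc D) rewrite sumFrom1-zero D = refl

sumFrom1-∑ : {A : Set} (D : ℕ) (xs : List A) (f : ℕ → A → ℤ) →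
  sumFrom1 D (λ j → ∑ xs (f j)) ≡ ∑ xs (λ x → sumFrom1 D (λ j → f j x))
sumFrom1-∑ zero xs f = sym (∑-zero xs)
sumFrom1-∑ (suc D) xs f = trans (cong (_+ℤ ∑ xs (f (suc D))) (sumFrom1-∑ D xs f))
  (sym (∑-distrib-+ xs (λ x → sumFrom1 D (λ j → f j x)) (f (suc D))))

≡ᵇ-false : ∀ v j → (v ≡ j → ⊥) → (v ≡ᵇ j) ≡ false
≡ᵇ-false v j v≢j = Bool.¬-not (λ e → v≢j (ℕ.≡ᵇ⇒≡ v j (subst T (sym e) _)))

≡ᵇ-refl : ∀ v → (v ≡ᵇ v) ≡ true
≡ᵇ-refl zero = refl
≡ᵇ-refl (suc v) = ≡ᵇ-refl v

sumFrom1-above : ∀ D v (h : ℕ → ℤ) → D < v → sumFrom1 D (λ j → 𝟙 (v ≡ᵇ j) *ℤ h j) ≡ 0ℤ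
sumFrom1-above zero v h D<v = refl
sumFrom1-above (suc D) v h D<v rewrite sumFrom1-above D v h (ℕ.<-trans ℕ.≤-refl D<v)
  | ≡ᵇ-false v (suc D) (λ e → ℕ.<-irrefl (sym e) D<v) = refl

sumFrom1-pick : ∀ D v (h : ℕ → ℤ) → 1 ≤ v → v ≤ D → sumFrom1 D (λ j → 𝟙 (v ≡ᵇ j) *ℤ h j) ≡ h v
sumFrom1-pick zero v h 1≤v v≤0 = ⊥-elim (ℕ.<-irrefl refl (ℕ.≤-trans 1≤v v≤0))
sumFrom1-pick (suc D) v h 1≤v v≤D with v ℕ.≟ suc D
... | yes refl rewrite sumFrom1-above D (suc D) h ℕ.≤-refl | ≡ᵇ-refl D =
  trans (ℤ.+-identityˡ _) (ℤ.*-identityˡ _)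
... | no v≢D rewrite sumFrom1-pick D v h 1≤v (ℕ.≤-pred (ℕ.≤∧≢⇒< v≤D v≢D)) | ≡ᵇ-false v (suc D) v≢D =
  ℤ.+-identityʳ (h v)

∑c≡∑Subsets : ∀ {n} (O : Rel n) (D : ℕ) (G : ℕ → ℤ) →
  sumFrom1 D (λ j → c j O *ℤ G j) ≡
    ∑Subsets n (λ B → sumFrom1 D (λ j →
      (𝟙 (forallFin n (λ x → B x ⇒b isMin O x) ∧ (dOn O (not ∘ B) ≡ᵇ j)) *ℤ signPow (size B)) *ℤ G j))
∑c≡∑Subsets {n} O D G = trans
  (sumFrom1-cong D (λ j → trans (cong (_*ℤ G j) (∑-filter _ (λ B → signPow (size B)) (allSubsets n)))
    (sym (∑-*ʳ (allSubsets n) (G j) _))))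
  (sumFrom1-∑ D (allSubsets n) _)

1≤dOn : ∀ {n} (O : Rel n) (S : Fin n → Bool) → 1 ≤ dOn O S
1≤dOn {n} O S = ℤ.drop‿+≤+ (begin
  1ℤ
    ≡⟨ cong 𝟙 ∅-downset ⟨
  𝟙 (isDownsetOn O S (λ _ → false))
    ≤⟨ ∅-≤-∑Subsets n (λ e → cong 𝟙 (cong₂ _∧_ (forallFin-cong n (λ x → cong (_⇒b S x) (e x)))
         (forallFin-cong n (λ x → forallFin-cong n (λ y → cong₂ (λ u w → (u ∧ S y ∧ O y x) ⇒b w) (e x) (e y))))))
         (𝟙-nonNeg ∘ isDownsetOn O S) ⟩
  ∑Subsets n (𝟙 ∘ isDownsetOn O S)
    ≡⟨ count≡∑𝟙 _ (allSubsets n) ⟨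
  + dOn O S ∎)
  where
  open ℤ.≤-Reasoning
  ∅-downset : isDownsetOn O S (λ _ → false) ≡ true
  ∅-downset = ∧-intro (forallFin-intro n (λ _ → refl)) (forallFin-intro n (λ _ → forallFin-intro n (λ _ → refl)))

dOn-outside≤d : ∀ {n} (O : Rel n) (B : Fin n → Bool) → (∀ x → B x ≡ true → isMin O x ≡ true) →
  dOn O (not ∘ B) ≤ d O
dOn-outside≤d {n} O B B-minimal = ℤ.drop‿+≤+ (begin
  + dOn O (not ∘ B)
    ≡⟨ ∑upsetsAvoiding≡dOn O B B-minimal ⟨
  ∑Subsets n (λ U → 𝟙 (isUpset O U ∧ avoids B U))
    ≤⟨ ∑-mono-≤ (allSubsets n) (λ U → 𝟙-mono (λ h → proj₁ (∧-elim {isUpset O U} h))) ⟩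
  ∑Subsets n (𝟙 ∘ isUpset O)
    ≡⟨ ∑upsets≡d O ⟩
  + d O ∎)
  where open ℤ.≤-Reasoning

module _ {a′ b : ℕ} (O : Rel (suc a′)) (P : Rel b) (m : ℕ) where

  private
    a : ℕ
    a = suc a′

    R : Rel (a + b)
    R = ordSum O P

  σ : (Fin a → Bool) → ℤ
  σ B = signPow (countTrue a B)

  allUpsets : Mat m (a + b) → Bool
  allUpsets F = every m (λ i → isUpset R (F i))

  uncovered : Mat m (a + b) → Fin a → Bool
  uncovered F x = isMin O x ∧ every m (λ i → not (F i (x ↑ˡ b)))

  minimalSubset : (Fin a → Bool) → Bool
  minimalSubset B = every a (λ x → B x ⇒b isMin O x)

  minimalSubset≡ : ∀ B → forallFin a (λ x → B x ⇒b isMin O x) ≡ minimalSubset B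
  minimalSubset≡ B = forallFin≡every a (λ x → B x ⇒b isMin O x)

  isUpsetCover-ordSum : (F : Mat m (a + b)) →
    isUpsetCover m R F ≡ allUpsets F ∧ every a (not ∘ uncovered F)
  isUpsetCover-ordSum F = cong (allUpsets F ∧_) (begin
    coversMinimal m R F
      ≡⟨ every-++ a b (λ x → isMin R x ⇒b some m (λ i → F i x)) ⟩
    every a (λ x → isMin R (x ↑ˡ b) ⇒b some m (λ i → F i (x ↑ˡ b)))
      ∧ every b (λ j → isMin R (a ↑ʳ j) ⇒b some m (λ i → F i (a ↑ʳ j)))
      ≡⟨ cong₂ _∧_ (every-cong a lower) (trans (every-cong b upper) (every-true b)) ⟩
    every a (not ∘ uncovered F) ∧ true
      ≡⟨ Bool.∧-identityʳ _ ⟩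
    every a (not ∘ uncovered F) ∎)
    where
    open ≡-Reasoning
    lower : ∀ x → (isMin R (x ↑ˡ b) ⇒b some m (λ i → F i (x ↑ˡ b))) ≡ not (uncovered F x)
    lower x = trans (cong₂ _⇒b_ (OrdinalSum.isMin-↑ˡ O P x) (some≡not-every-not m (λ i → F i (x ↑ˡ b))))
      (⇒b-not (isMin O x) _)

    upper : ∀ j → (isMin R (a ↑ʳ j) ⇒b some m (λ i → F i (a ↑ʳ j))) ≡ true
    upper j rewrite OrdinalSum.isMin-↑ʳ O P j | Bool.∧-zeroʳ (isMin P j) = refl

  every-⇒-uncovered : (F : Mat m (a + b)) (B : Fin a → Bool) →
    every a (λ x → B x ⇒b uncovered F x) ≡ minimalSubset B ∧ every m (λ i → avoids B (λ x → F i (x ↑ˡ b)))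
  every-⇒-uncovered F B = begin
    every a (λ x → B x ⇒b uncovered F x)
      ≡⟨ every-cong a (λ x → ⇒b-∧ (B x) (isMin O x) (every m (λ i → not (F i (x ↑ˡ b))))) ⟩
    every a (λ x → (B x ⇒b isMin O x) ∧ (B x ⇒b every m (λ i → not (F i (x ↑ˡ b)))))
      ≡⟨ every-∧ a (λ x → B x ⇒b isMin O x) (λ x → B x ⇒b every m (λ i → not (F i (x ↑ˡ b)))) ⟩
    minimalSubset B ∧ every a (λ x → B x ⇒b every m (λ i → not (F i (x ↑ˡ b))))
      ≡⟨ cong (minimalSubset B ∧_) (trans (every-cong a (λ x → ⇒b-every (B x) m (λ i → not (F i (x ↑ˡ b)))))
           (every-comm a m (λ x i → B x ⇒b not (F i (x ↑ˡ b))))) ⟩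
    minimalSubset B ∧ every m (λ i → avoids B (λ x → F i (x ↑ˡ b))) ∎
    where open ≡-Reasoning

  upsetAvoiding : (Fin a → Bool) → (Fin (a + b) → Bool) → Bool
  upsetAvoiding B U = isUpset R U ∧ avoids B (λ x → U (x ↑ˡ b))

  upsetsAvoiding : (Fin a → Bool) → ℤ
  upsetsAvoiding B = ∑Subsets (a + b) (𝟙 ∘ upsetAvoiding B)

  signedTerm-factor : (F : Mat m (a + b)) (B : Fin a → Bool) →
    𝟙 (allUpsets F) *ℤ (𝟙 (every a (λ x → B x ⇒b uncovered F x)) *ℤ σ B)
      ≡ (𝟙 (minimalSubset B) *ℤ σ B) *ℤ ∏ m (λ i → 𝟙 (upsetAvoiding B (F i)))
  signedTerm-factor F B = begin
    𝟙 (allUpsets F) *ℤ (𝟙 (every a (λ x → B x ⇒b uncovered F x)) *ℤ σ B)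
      ≡⟨ cong (λ w → 𝟙 (allUpsets F) *ℤ (w *ℤ σ B))
           (trans (cong 𝟙 (every-⇒-uncovered F B)) (𝟙-∧ (minimalSubset B) avoiding)) ⟩
    𝟙 (allUpsets F) *ℤ ((𝟙 (minimalSubset B) *ℤ 𝟙 avoiding) *ℤ σ B)
      ≡⟨ rearrange (𝟙 (allUpsets F)) (𝟙 (minimalSubset B)) (𝟙 avoiding) (σ B) ⟩
    (𝟙 (minimalSubset B) *ℤ σ B) *ℤ (𝟙 (allUpsets F) *ℤ 𝟙 avoiding)
      ≡⟨ cong ((𝟙 (minimalSubset B) *ℤ σ B) *ℤ_) (sym (𝟙-∧ (allUpsets F) avoiding)) ⟩
    (𝟙 (minimalSubset B) *ℤ σ B) *ℤ 𝟙 (allUpsets F ∧ avoiding)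
      ≡⟨ cong (λ w → (𝟙 (minimalSubset B) *ℤ σ B) *ℤ 𝟙 w)
           (sym (every-∧ m (λ i → isUpset R (F i)) (λ i → avoids B (λ x → F i (x ↑ˡ b))))) ⟩
    (𝟙 (minimalSubset B) *ℤ σ B) *ℤ 𝟙 (every m (λ i → upsetAvoiding B (F i)))
      ≡⟨ cong ((𝟙 (minimalSubset B) *ℤ σ B) *ℤ_) (𝟙-every m (λ i → upsetAvoiding B (F i))) ⟩
    (𝟙 (minimalSubset B) *ℤ σ B) *ℤ ∏ m (λ i → 𝟙 (upsetAvoiding B (F i))) ∎
    where
    open ≡-Reasoning
    avoiding : Bool
    avoiding = every m (λ i → avoids B (λ x → F i (x ↑ˡ b)))

    rearrange : ∀ u s v t → u *ℤ ((s *ℤ v) *ℤ t) ≡ (s *ℤ t) *ℤ (u *ℤ v)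
    rearrange = solve-∀

  -- Inclusion–exclusion over the set B of minimal elements of O that no row of F contains.
  e-ordSum-signed : IsPoset O → IsPoset P →
    + e m R ≡ ∑Subsets a (λ B → (𝟙 (minimalSubset B) *ℤ σ B) *ℤ ∏ m (λ _ → upsetsAvoiding B))
  e-ordSum-signed pO pP = begin
    + e m R
      ≡⟨ e≡∑upsetCovers m R (ordSum-IsPoset O P pO pP) ⟩
    ∑Mat m (a + b) (𝟙 ∘ isUpsetCover m R)
      ≡⟨ ∑-cong (allFns m rows) (λ F → trans (cong 𝟙 (isUpsetCover-ordSum F)) (𝟙-∧ (allUpsets F) _)) ⟩
    ∑Mat m (a + b) (λ F → 𝟙 (allUpsets F) *ℤ 𝟙 (every a (not ∘ uncovered F)))
      ≡⟨ ∑-cong (allFns m rows) (λ F →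
           cong (𝟙 (allUpsets F) *ℤ_) (∑Subsets-inclusion–exclusion a (uncovered F))) ⟨
    ∑Mat m (a + b) (λ F → 𝟙 (allUpsets F) *ℤ ∑Subsets a (λ B → 𝟙 (every a (λ x → B x ⇒b uncovered F x)) *ℤ σ B))
      ≡⟨ ∑-cong (allFns m rows) (λ F → ∑-*ˡ (allSubsets a) (𝟙 (allUpsets F)) _) ⟨
    ∑Mat m (a + b) (λ F → ∑Subsets a (λ B → 𝟙 (allUpsets F) *ℤ (𝟙 (every a (λ x → B x ⇒b uncovered F x)) *ℤ σ B)))
      ≡⟨ ∑-comm (allFns m rows) (allSubsets a) _ ⟩
    ∑Subsets a (λ B → ∑Mat m (a + b) (λ F → 𝟙 (allUpsets F) *ℤ (𝟙 (every a (λ x → B x ⇒b uncovered F x)) *ℤ σ B)))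
      ≡⟨ ∑-cong (allSubsets a) (λ B → ∑-cong (allFns m rows) (λ F → signedTerm-factor F B)) ⟩
    ∑Subsets a (λ B → ∑Mat m (a + b) (λ F → (𝟙 (minimalSubset B) *ℤ σ B) *ℤ ∏ m (λ i → 𝟙 (upsetAvoiding B (F i)))))
      ≡⟨ ∑-cong (allSubsets a) (λ B → trans (∑-*ˡ (allFns m rows) (𝟙 (minimalSubset B) *ℤ σ B) _)
           (cong ((𝟙 (minimalSubset B) *ℤ σ B) *ℤ_) (∑Fns-∏ m rows (λ _ → 𝟙 ∘ upsetAvoiding B)))) ⟩
    ∑Subsets a (λ B → (𝟙 (minimalSubset B) *ℤ σ B) *ℤ ∏ m (λ _ → upsetsAvoiding B)) ∎
    where
    open ≡-Reasoning
    rows : List (Fin (a + b) → Bool)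
    rows = allSubsets (a + b)

  minimalSubset-elim : ∀ {B} → minimalSubset B ≡ true → ∀ x → B x ≡ true → isMin O x ≡ true
  minimalSubset-elim {B} μ x = ⇒b-elim (every-elim a {λ y → B y ⇒b isMin O y} μ x)

  upsetsAvoiding≡ : ∀ B → minimalSubset B ≡ true → upsetsAvoiding B ≡ + (dOn O (not ∘ B) + d P ∸ 1)
  -- Matching on 1 ≤ d(O − B) exposes a successor, so that the truncated subtraction ∸ 1 computes.
  upsetsAvoiding≡ B μ with dOn O (not ∘ B) | 1≤dOn O (not ∘ B) | ∑upsetsAvoiding-ordSum O P B (minimalSubset-elim μ)
  ... | suc v | _ | count = count

  signedTerm≡∑c-terms : (B : Fin a → Bool) →
    (𝟙 (minimalSubset B) *ℤ σ B) *ℤ ∏ m (λ _ → upsetsAvoiding B)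
      ≡ sumFrom1 (d O) (λ j → (𝟙 (forallFin a (λ x → B x ⇒b isMin O x) ∧ (dOn O (not ∘ B) ≡ᵇ j))
                                *ℤ signPow (size B)) *ℤ + ((j + d P ∸ 1) ^ m))
  signedTerm≡∑c-terms B with minimalSubset B in μ
  ... | false = sym (trans (sumFrom1-cong (d O) (λ j →
          cong (λ w → (𝟙 (w ∧ (dOn O (not ∘ B) ≡ᵇ j)) *ℤ signPow (size B)) *ℤ + ((j + d P ∸ 1) ^ m))
            (trans (minimalSubset≡ B) μ)))
        (sumFrom1-zero (d O)))
  ... | true = begin
    (1ℤ *ℤ σ B) *ℤ ∏ m (λ _ → upsetsAvoiding B)
      ≡⟨ cong₂ _*ℤ_ (ℤ.*-identityˡ (σ B)) (trans (∏-cong m (λ _ → upsetsAvoiding≡ B μ)) (∏-const m _)) ⟩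
    σ B *ℤ G Dv
      ≡⟨ sumFrom1-pick (d O) Dv (λ j → σ B *ℤ G j) (1≤dOn O (not ∘ B)) (dOn-outside≤d O B (minimalSubset-elim μ)) ⟨
    sumFrom1 (d O) (λ j → 𝟙 (Dv ≡ᵇ j) *ℤ (σ B *ℤ G j))
      ≡⟨ sumFrom1-cong (d O) (λ j → trans (sym (ℤ.*-assoc (𝟙 (Dv ≡ᵇ j)) _ (G j)))
           (cong₂ (λ u w → (𝟙 (u ∧ (Dv ≡ᵇ j)) *ℤ w) *ℤ G j)
             (sym (trans (minimalSubset≡ B) μ)) (cong signPow (sym (size≡countTrue a B))))) ⟩
    sumFrom1 (d O) (λ j → (𝟙 (forallFin a (λ x → B x ⇒b isMin O x) ∧ (Dv ≡ᵇ j)) *ℤ signPow (size B)) *ℤ G j) ∎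
    where
    open ≡-Reasoning
    Dv : ℕ
    Dv = dOn O (not ∘ B)
    G : ℕ → ℤ
    G j = + ((j + d P ∸ 1) ^ m)

  e-ordSum : IsPoset O → IsPoset P →
    + e m R ≡ sumFrom1 (d O) (λ j → c j O *ℤ + ((j + d P ∸ 1) ^ m))
  e-ordSum pO pP = begin
    + e m R
      ≡⟨ e-ordSum-signed pO pP ⟩
    ∑Subsets a (λ B → (𝟙 (minimalSubset B) *ℤ σ B) *ℤ ∏ m (λ _ → upsetsAvoiding B))
      ≡⟨ ∑-cong (allSubsets a) signedTerm≡∑c-terms ⟩
    ∑Subsets a (λ B → sumFrom1 (d O) (λ j → (𝟙 (forallFin a (λ x → B x ⇒b isMin O x) ∧ (dOn O (not ∘ B) ≡ᵇ j))
                                             *ℤ signPow (size B)) *ℤ + ((j + d P ∸ 1) ^ m)))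
      ≡⟨ ∑c≡∑Subsets O (d O) (λ j → + ((j + d P ∸ 1) ^ m)) ⟨
    sumFrom1 (d O) (λ j → c j O *ℤ + ((j + d P ∸ 1) ^ m)) ∎
    where open ≡-Reasoning

theorem4p4 : (a b : ℕ) (O : Rel a) (P : Rel b) → IsPoset O → IsPoset P → (m : ℕ) →
    (e m (cardSum O P) ≡ e m O * e m P)
    × (a ≥ 1 → + e m (ordSum O P) ≡ sumFrom1 (d O) (λ j → c j O *ℤ + ((j + d P ∸ 1) ^ m)))
theorem4p4 zero b O P pO pP m = e-cardSum O P pO pP m , λ ()
theorem4p4 (suc a) b O P pO pP m = e-cardSum O P pO pP m , λ _ → e-ordSum O P m pO pP
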